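{- Let $v_1,\ldots,v_p$ be positive integers. The complete multipartite graph $K_{v_1,v_2,\ldots,v_p}$ is $\{ -1,0,1\}$-diagonalizable if and only if the vector $(v_1,v_2,\ldots,v_p)$ is balanced. If it is $\{ -1,0,1\}$-diagonalizable, then its $\{ -1,0,1\}$-bandwidth is at most $\max\{2,p-1\}$.
   Context: For a simple graph with adjacency matrix $A$ and degree matrix $D$, the Laplacian is $L=D-A$. A graph is $\{ -1,0,1\}$-diagonalizable if there is an invertible matrix $P$ with entries in $\{ -1,0,1\}$ such that $P^{ -1}LP$ is diagonal. The bandwidth of a square matrix $M$ is the smallest positive integer $k$ with $m_{i,j}=0$ whenever $|i-j|\ge k$. The $\{ -1,0,1\}$-bandwidth of a $\{ -1,0,1\}$-diagonalizable graph is the smallest positive integer $k$ for which there is a matrix $P$ with entries in $\{ -1,0,1\}$, $P^{ -1}LP$ diagonal and $P^TP$ of bandwidth $k$. A vector $\mathbf{v}\in\mathbb{R}^p$, $p\ge2$, is balanced if there exists a $(p-1)\times p$ matrix with all entries in $\{ -1,0,1\}$ whose null space equals $\mathrm{span}(\mathbf{v})$; by convention a vector in $\mathbb{R}^1$ is balanced iff it is non-zero. -}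

module Defs where

open import Data.Nat as ℕ using (ℕ; zero; suc; ∣_-_∣; _≤_)
open import Data.Integer using (+_)
open import Data.Fin using (Fin; zero; suc; toℕ; splitAt; _≟_)
open import Data.Sum using (_⊎_; inj₁; inj₂)
open import Data.Product using (Σ; _×_; ∃)
open import Data.Empty using (⊥)
open import Relation.Nullary using (¬_; yes; no)
open import Relation.Binary.PropositionalEquality using (_≡_; _≢_)
open import Data.Rational as ℚ using (ℚ; 0ℚ; 1ℚ; _+_; _*_; _-_; -_; _/_)

ℕ→ℚ : ℕ → ℚ
ℕ→ℚ n = (+ n) / 1

∑ : ∀ {n} → (Fin n → ℚ) → ℚ
∑ {zero}  f = 0ℚ
∑ {suc n} f = f zero + ∑ (λ i → f (suc i))

Mat : ℕ → ℕ → Set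
Mat m n = Fin m → Fin n → ℚ

_·_ : ∀ {m n k} → Mat m n → Mat n k → Mat m k
(A · B) i j = ∑ (λ l → A i l * B l j)

_ᵀ : ∀ {m n} → Mat m n → Mat n m
(A ᵀ) i j = A j i

I : ∀ {n} → Mat n n
I i j with i ≟ j
... | yes _ = 1ℚ
... | no  _ = 0ℚ

data Trit : Set where
  neg zer pos : Trit

trit : Trit → ℚ
trit neg = - 1ℚ
trit zer = 0ℚ
trit pos = 1ℚ

⟦_⟧ : ∀ {m n} → (Fin m → Fin n → Trit) → Mat m n
⟦ P ⟧ i j = trit (P i j)

degree : ∀ {n} → Mat n n → Fin n → ℚ
degree A i = ∑ (λ j → A i j)

laplacian : ∀ {n} → Mat n n → Mat n n
laplacian A i j with i ≟ j
... | yes _ = degree A i - A i j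
... | no  _ = 0ℚ - A i j

-- Complete multipartite graph K_{v_1,...,v_p}
-- Vertex set Fin (v_1 + ... + v_p): the first v_1 vertices form part 1,
-- the next v_2 vertices form part 2, etc.

total : (p : ℕ) → (Fin p → ℕ) → ℕ
total zero    v = 0
total (suc p) v = v zero ℕ.+ total p (λ i → v (suc i))

part : (p : ℕ) (v : Fin p → ℕ) → Fin (total p v) → Fin p
part (suc p) v x with splitAt (v zero) x
... | inj₁ _ = zero
... | inj₂ y = suc (part p (λ i → v (suc i)) y)

multipartiteAdj : (p : ℕ) (v : Fin p → ℕ) → Mat (total p v) (total p v)
multipartiteAdj p v x y with part p v x ≟ part p v y
... | yes _ = 0ℚ
... | no  _ = 1ℚ

multipartiteLaplacian : (p : ℕ) (v : Fin p → ℕ) → Mat (total p v) (total p v)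
multipartiteLaplacian p v = laplacian (multipartiteAdj p v)

IsDiagonal : ∀ {n} → Mat n n → Set
IsDiagonal M = ∀ i j → i ≢ j → M i j ≡ 0ℚ

IsInverse : ∀ {n} → Mat n n → Mat n n → Set
IsInverse Q M = (∀ i j → (Q · M) i j ≡ I i j) × (∀ i j → (M · Q) i j ≡ I i j)

Diagonalizes : ∀ {n} → Mat n n → (Fin n → Fin n → Trit) → Set
Diagonalizes L P = Σ (Mat _ _) (λ Q → IsInverse Q ⟦ P ⟧ × IsDiagonal (Q · (L · ⟦ P ⟧)))

TritDiagonalizable : ∀ {n} → Mat n n → Set
TritDiagonalizable {n} L = Σ (Fin n → Fin n → Trit) (λ P → Diagonalizes L P)

BandwidthAtMost : ∀ {n} → Mat n n → ℕ → Set
BandwidthAtMost M k = ∀ i j → k ≤ ∣ toℕ i - toℕ j ∣ → M i j ≡ 0ℚ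

TritBandwidthAtMost : ∀ {n} → Mat n n → ℕ → Set
TritBandwidthAtMost {n} L k =
  Σ (Fin n → Fin n → Trit) (λ P → Diagonalizes L P × BandwidthAtMost ((⟦ P ⟧ ᵀ) · ⟦ P ⟧) k)

NullSpaceIsSpan : ∀ {m n} → Mat m n → (Fin n → ℚ) → Set
NullSpaceIsSpan {m} {n} M v =
  (x : Fin n → ℚ) →
    ((∀ i → ∑ (λ j → M i j * x j) ≡ 0ℚ) → Σ ℚ (λ c → ∀ j → x j ≡ c * v j))
  × (Σ ℚ (λ c → ∀ j → x j ≡ c * v j) → (∀ i → ∑ (λ j → M i j * x j) ≡ 0ℚ))

Balanced : (p : ℕ) → (Fin p → ℚ) → Set
Balanced zero          v = ⊥   -- ℝ⁰ is not covered by the definition (p ≥ 1 assumed)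
Balanced (suc zero)    v = ¬ (v zero ≡ 0ℚ)
Balanced (suc (suc k)) v =
  Σ (Fin (suc k) → Fin (suc (suc k)) → Trit) (λ M → NullSpaceIsSpan ⟦ M ⟧ v)

-- The Laplacian L of K_{v₁,…,v_p} (n vertices) has three kinds of eigenvectors: the all-ones vector (eigenvalue 0),
-- vectors constant on the parts whose values g satisfy Σ vᵢ gᵢ = 0 (eigenvalue n), and vectors supported in part i
-- with zero sum (eigenvalue n - vᵢ).
--
-- Only if: if P⁻¹ L P is diagonal, the columns of P with eigenvalue n are constant on the parts and span the whole
-- n-eigenspace; reading each of them off on one vertex per part gives a {-1,0,1}-matrix whose null space is span v,
-- and discarding dependent rows leaves p - 1 of them.
--
-- If: given such a (p-1) × p matrix M, take as columns of P the all-ones vector, the rows of M lifted to the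
-- vertices, and the differences of consecutive vertices inside each part. They are eigenvectors and a basis. In
-- this order PᵀP vanishes at distance ≥ max{2, p-1}: differences are orthogonal to everything constant on parts,
-- the lifted rows of M are orthogonal to the all-ones vector, and differences two apart have disjoint supports.

module Submission where

open import Defs
open import Data.Nat as ℕ using (ℕ; zero; suc; s≤s; z≤n; _≤_; _⊔_; _∸_)
import Data.Nat.Properties as ℕ
open import Data.Fin as Fin using (Fin; zero; suc; punchIn; punchOut; _↑ˡ_; _↑ʳ_; splitAt; toℕ)
import Data.Fin.Properties as Fin
import Data.Integer as ℤ
import Data.Integer.Properties as ℤ
open import Data.Rational using (ℚ; 0ℚ; 1ℚ; _+_; _*_; _-_; -_; _/_; mkℚ; 1/_; ≢-nonZero)
open import Data.Rational.Properties
open import Data.Rational.Solver using (module +-*-Solver)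
import Data.Nat.Coprimality as Coprime
open import Algebra.Properties.Group +-0-group using (x∙y⁻¹≈ε⇒x≈y; inverseʳ-unique)
open import Data.Empty using (⊥-elim)
open import Data.Vec.Functional using (Vector; insertAt)
open import Data.Vec.Functional.Properties using (insertAt-lookup; insertAt-punchIn)
open import Data.Sum using (_⊎_; inj₁; inj₂; [_,_]′)
open import Data.Product using (Σ; ∃; _×_; _,_; proj₁; proj₂)
open import Function.Bundles using (_⇔_; mk⇔)
open import Relation.Nullary using (Dec; yes; no; contradiction)
open import Relation.Binary.PropositionalEquality

open +-*-Solver using (solve; _:=_; _:+_; _:*_; _:-_; :-_; con)
open ≡-Reasoning

x-y≡0⇒x≡y : ∀ {x y} → x - y ≡ 0ℚ → x ≡ y
x-y≡0⇒x≡y = x∙y⁻¹≈ε⇒x≈y _ _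

x+y≡0⇒y≡-x : ∀ {x y} → x + y ≡ 0ℚ → y ≡ - x
x+y≡0⇒y≡-x = inverseʳ-unique _ _

*-inverseˡ-≢0 : ∀ c (c≢0 : c ≢ 0ℚ) → 1/_ c {{≢-nonZero c≢0}} * c ≡ 1ℚ
*-inverseˡ-≢0 c c≢0 = *-inverseˡ c {{≢-nonZero c≢0}}

*-cancelˡ-≢0 : ∀ c {x y} → c ≢ 0ℚ → c * x ≡ c * y → x ≡ y
*-cancelˡ-≢0 c {x} {y} c≢0 cx≡cy = begin
  x                 ≡⟨ solve 1 (λ x → x := con 1ℚ :* x) refl x ⟩
  1ℚ * x            ≡⟨ cong (_* x) (sym (*-inverseˡ-≢0 c c≢0)) ⟩
  (c⁻¹ * c) * x     ≡⟨ *-assoc c⁻¹ c x ⟩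
  c⁻¹ * (c * x)     ≡⟨ cong (c⁻¹ *_) cx≡cy ⟩
  c⁻¹ * (c * y)     ≡⟨ sym (*-assoc c⁻¹ c y) ⟩
  (c⁻¹ * c) * y     ≡⟨ cong (_* y) (*-inverseˡ-≢0 c c≢0) ⟩
  1ℚ * y            ≡⟨ *-identityˡ y ⟩
  y                 ∎
  where c⁻¹ = 1/_ c {{≢-nonZero c≢0}}

c*x≡0⇒x≡0 : ∀ c {x} → c ≢ 0ℚ → c * x ≡ 0ℚ → x ≡ 0ℚ
c*x≡0⇒x≡0 c c≢0 cx≡0 = *-cancelˡ-≢0 c c≢0 (trans cx≡0 (sym (*-zeroʳ c)))

ℕ→ℚ-mkℚ : ∀ n → ℕ→ℚ n ≡ mkℚ (ℤ.+ n) 0 (Coprime.sym (Coprime.1-coprimeTo n))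
ℕ→ℚ-mkℚ n = normalize-coprime _

ℕ→ℚ-+ : ∀ m n → ℕ→ℚ (m ℕ.+ n) ≡ ℕ→ℚ m + ℕ→ℚ n
ℕ→ℚ-+ m n rewrite ℕ→ℚ-mkℚ m | ℕ→ℚ-mkℚ n =
  cong (_/ 1) (cong₂ ℤ._+_ (sym (ℤ.*-identityʳ (ℤ.+ m))) (sym (ℤ.*-identityʳ (ℤ.+ n))))

ℕ→ℚ-≢0 : ∀ {n} → 1 ≤ n → ℕ→ℚ n ≢ 0ℚ
ℕ→ℚ-≢0 {suc n} _ eq with trans (sym (ℕ→ℚ-mkℚ (suc n))) eq
... | ()

-- Finite sums and matrices

∑-cong : ∀ {n} {f g : Fin n → ℚ} → (∀ i → f i ≡ g i) → ∑ f ≡ ∑ g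
∑-cong {zero}  f≗g = refl
∑-cong {suc n} f≗g = cong₂ _+_ (f≗g zero) (∑-cong (λ i → f≗g (suc i)))

∑-zero : ∀ {n} {f : Fin n → ℚ} → (∀ i → f i ≡ 0ℚ) → ∑ f ≡ 0ℚ
∑-zero {zero}  f≗0 = refl
∑-zero {suc n} f≗0 = trans (cong₂ _+_ (f≗0 zero) (∑-zero (λ i → f≗0 (suc i)))) (+-identityˡ 0ℚ)

∑-+ : ∀ {n} (f g : Fin n → ℚ) → ∑ (λ i → f i + g i) ≡ ∑ f + ∑ g
∑-+ {zero}  f g = refl
∑-+ {suc n} f g = begin
  (f zero + g zero) + ∑ (λ i → f (suc i) + g (suc i))
    ≡⟨ cong ((f zero + g zero) +_) (∑-+ (λ i → f (suc i)) (λ i → g (suc i))) ⟩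
  (f zero + g zero) + (F + G)
    ≡⟨ solve 4 (λ a b c d → (a :+ b) :+ (c :+ d) := (a :+ c) :+ (b :+ d)) refl (f zero) (g zero) F G ⟩
  (f zero + F) + (g zero + G) ∎
  where F = ∑ (λ i → f (suc i)); G = ∑ (λ i → g (suc i))

∑-*ˡ : ∀ {n} c (f : Fin n → ℚ) → c * ∑ f ≡ ∑ (λ i → c * f i)
∑-*ˡ {zero}  c f = *-zeroʳ c
∑-*ˡ {suc n} c f = trans (*-distribˡ-+ c (f zero) _) (cong (c * f zero +_) (∑-*ˡ c (λ i → f (suc i))))

∑-*ʳ : ∀ {n} c (f : Fin n → ℚ) → ∑ f * c ≡ ∑ (λ i → f i * c)
∑-*ʳ c f = trans (*-comm _ c) (trans (∑-*ˡ c f) (∑-cong (λ i → *-comm c (f i))))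

∑-neg : ∀ {n} (f : Fin n → ℚ) → - ∑ f ≡ ∑ (λ i → - f i)
∑-neg {zero}  f = refl
∑-neg {suc n} f = trans (neg-distrib-+ (f zero) _) (cong (- f zero +_) (∑-neg (λ i → f (suc i))))

∑-- : ∀ {n} (f g : Fin n → ℚ) → ∑ (λ i → f i - g i) ≡ ∑ f - ∑ g
∑-- f g = trans (∑-+ f (λ i → - g i)) (cong (∑ f +_) (sym (∑-neg g)))

∑-comm : ∀ {m n} (f : Fin m → Fin n → ℚ) → ∑ (λ i → ∑ (f i)) ≡ ∑ (λ j → ∑ (λ i → f i j))
∑-comm {zero}  {n} f = sym (∑-zero {n} (λ j → refl))
∑-comm {suc m} f = begin
  ∑ (f zero) + ∑ (λ i → ∑ (f (suc i)))          ≡⟨ cong (∑ (f zero) +_) (∑-comm (λ i → f (suc i))) ⟩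
  ∑ (f zero) + ∑ (λ j → ∑ (λ i → f (suc i) j))  ≡⟨ sym (∑-+ (f zero) _) ⟩
  ∑ (λ j → f zero j + ∑ (λ i → f (suc i) j))    ∎

∑-splitAt : ∀ m n (f : Fin (m ℕ.+ n) → ℚ) → ∑ f ≡ ∑ (λ i → f (i ↑ˡ n)) + ∑ (λ j → f (m ↑ʳ j))
∑-splitAt zero    n f = sym (+-identityˡ _)
∑-splitAt (suc m) n f =
  trans (cong (f zero +_) (∑-splitAt m n (λ x → f (suc x)))) (sym (+-assoc (f zero) _ _))

∑-punchIn : ∀ {n} (k : Fin (suc n)) (f : Fin (suc n) → ℚ) → ∑ f ≡ f k + ∑ (λ j → f (punchIn k j))
∑-punchIn zero f = refl
∑-punchIn {suc n} (suc k) f = begin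
  f zero + ∑ (λ i → f (suc i))                              ≡⟨ cong (f zero +_) (∑-punchIn k (λ i → f (suc i))) ⟩
  f zero + (f (suc k) + ∑ (λ j → f (suc (punchIn k j))))    ≡⟨ solve 3 (λ a b c → a :+ (b :+ c) := b :+ (a :+ c)) refl (f zero) (f (suc k)) _ ⟩
  f (suc k) + (f zero + ∑ (λ j → f (suc (punchIn k j))))    ∎

∑-single : ∀ {n} (k : Fin n) (f : Fin n → ℚ) → (∀ j → j ≢ k → f j ≡ 0ℚ) → ∑ f ≡ f k
∑-single {suc n} k f f≗0 = begin
  ∑ f                                 ≡⟨ ∑-punchIn k f ⟩
  f k + ∑ (λ j → f (punchIn k j))     ≡⟨ cong (f k +_) (∑-zero (λ j → f≗0 (punchIn k j) (Fin.punchInᵢ≢i k j))) ⟩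
  f k + 0ℚ                            ≡⟨ +-identityʳ (f k) ⟩
  f k                                 ∎

∑-const : ∀ n c → ∑ {n} (λ _ → c) ≡ ℕ→ℚ n * c
∑-const zero    c = sym (*-zeroˡ c)
∑-const (suc n) c = begin
  c + ∑ {n} (λ _ → c)     ≡⟨ cong (c +_) (∑-const n c) ⟩
  c + ℕ→ℚ n * c           ≡⟨ solve 2 (λ c m → c :+ m :* c := (con 1ℚ :+ m) :* c) refl c (ℕ→ℚ n) ⟩
  (1ℚ + ℕ→ℚ n) * c        ≡⟨ cong (_* c) (sym (ℕ→ℚ-+ 1 n)) ⟩
  ℕ→ℚ (suc n) * c         ∎

∑-1 : ∀ n → ∑ {n} (λ _ → 1ℚ) ≡ ℕ→ℚ n
∑-1 n = trans (∑-const n 1ℚ) (*-identityʳ (ℕ→ℚ n))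

∑-cast : ∀ {m n} (eq : m ≡ n) (f : Fin n → ℚ) → ∑ (λ i → f (Fin.cast eq i)) ≡ ∑ f
∑-cast refl f = ∑-cong (λ i → cong f (Fin.cast-is-id refl i))

I-diag : ∀ {n} (i : Fin n) → I i i ≡ 1ℚ
I-diag i with i Fin.≟ i
... | yes _  = refl
... | no i≢i = ⊥-elim (i≢i refl)

I-offdiag : ∀ {n} {i j : Fin n} → i ≢ j → I i j ≡ 0ℚ
I-offdiag {i = i} {j} i≢j with i Fin.≟ j
... | yes i≡j = ⊥-elim (i≢j i≡j)
... | no _    = refl

I-suc : ∀ {n} (i j : Fin n) → I (suc i) (suc j) ≡ I i j
I-suc i j with i Fin.≟ j
... | yes refl = refl
... | no _     = refl

I-sym : ∀ {n} (i j : Fin n) → I i j ≡ I j i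
I-sym i j with i Fin.≟ j
... | yes refl = sym (I-diag i)
... | no i≢j   = sym (I-offdiag (λ j≡i → i≢j (sym j≡i)))

I-cast : ∀ {m n} (eq : m ≡ n) (i j : Fin m) → I (Fin.cast eq i) (Fin.cast eq j) ≡ I i j
I-cast refl i j = cong₂ I (Fin.cast-is-id refl i) (Fin.cast-is-id refl j)

I-toℕ : ∀ {n} {i j : Fin n} → toℕ i ≢ toℕ j → I i j ≡ 0ℚ
I-toℕ i≉j = I-offdiag (λ i≡j → i≉j (cong toℕ i≡j))

∑-I : ∀ {n} (i : Fin n) (f : Fin n → ℚ) → ∑ (λ j → I i j * f j) ≡ f i
∑-I i f = trans (∑-single i (λ j → I i j * f j) I≗0) (trans (cong (_* f i) (I-diag i)) (*-identityˡ (f i)))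
  where
  I≗0 : ∀ j → j ≢ i → I i j * f j ≡ 0ℚ
  I≗0 j j≢i = trans (cong (_* f j) (I-offdiag (λ i≡j → j≢i (sym i≡j)))) (*-zeroˡ (f j))

∑-Iʳ : ∀ {n} (i : Fin n) (f : Fin n → ℚ) → ∑ (λ j → f j * I j i) ≡ f i
∑-Iʳ i f = trans (∑-cong (λ j → trans (*-comm (f j) _) (cong (_* f j) (I-sym j i)))) (∑-I i f)

∑-I-antisym : ∀ {n} (z a : Fin n → ℚ) i k → ∑ (λ j → z j * (I i j * a k - I k j * a i)) ≡ z i * a k - z k * a i
∑-I-antisym z a i k = begin
  ∑ (λ j → z j * (I i j * a k - I k j * a i))
    ≡⟨ ∑-cong (λ j → solve 5 (λ z x b y c → z :* (x :* b :- y :* c) := x :* (z :* b) :- y :* (z :* c)) refl (z j) (I i j) (a k) (I k j) (a i)) ⟩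
  ∑ (λ j → I i j * (z j * a k) - I k j * (z j * a i))
    ≡⟨ ∑-- (λ j → I i j * (z j * a k)) (λ j → I k j * (z j * a i)) ⟩
  ∑ (λ j → I i j * (z j * a k)) - ∑ (λ j → I k j * (z j * a i))
    ≡⟨ cong₂ _-_ (∑-I i (λ j → z j * a k)) (∑-I k (λ j → z j * a i)) ⟩
  z i * a k - z k * a i ∎

·-assoc : ∀ {m n k l} (A : Mat m n) (B : Mat n k) (C : Mat k l) i j → ((A · B) · C) i j ≡ (A · (B · C)) i j
·-assoc A B C i j = begin
  ∑ (λ l → ∑ (λ k → A i k * B k l) * C l j)  ≡⟨ ∑-cong (λ l → ∑-*ʳ (C l j) (λ k → A i k * B k l)) ⟩
  ∑ (λ l → ∑ (λ k → A i k * B k l * C l j))  ≡⟨ ∑-comm (λ l k → A i k * B k l * C l j) ⟩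
  ∑ (λ k → ∑ (λ l → A i k * B k l * C l j))  ≡⟨ ∑-cong (λ k → trans (∑-cong (λ l → *-assoc (A i k) (B k l) (C l j))) (sym (∑-*ˡ (A i k) (λ l → B k l * C l j)))) ⟩
  ∑ (λ k → A i k * ∑ (λ l → B k l * C l j))  ∎

I-· : ∀ {m n} (A : Mat m n) i j → (I · A) i j ≡ A i j
I-· A i j = ∑-I i (λ k → A k j)

·-I : ∀ {m n} (A : Mat m n) i j → (A · I) i j ≡ A i j
·-I A i j = ∑-Iʳ j (A i)

·-diagonal : ∀ {m n} (A : Mat m n) {D : Mat n n} → IsDiagonal D → ∀ i j → (A · D) i j ≡ A i j * D j j
·-diagonal A {D} D-diag i j = ∑-single j (λ k → A i k * D k j) D≗0
  where
  D≗0 : ∀ k → k ≢ j → A i k * D k j ≡ 0ℚ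
  D≗0 k k≢j = trans (cong (A i k *_) (D-diag k j k≢j)) (*-zeroʳ (A i k))

IsZero : ∀ {n} → Vector ℚ n → Set
IsZero x = ∀ i → x i ≡ 0ℚ

infix 20 _·ᵥ_ _ᵥ·_

_·ᵥ_ : ∀ {m n} → Mat m n → Vector ℚ n → Vector ℚ m
(A ·ᵥ x) i = ∑ (λ j → A i j * x j)

_ᵥ·_ : ∀ {m n} → Vector ℚ m → Mat m n → Vector ℚ n
(y ᵥ· A) j = ∑ (λ i → y i * A i j)

·ᵥ-cong : ∀ {m n} (A : Mat m n) {x y : Vector ℚ n} → (∀ j → x j ≡ y j) → ∀ i → (A ·ᵥ x) i ≡ (A ·ᵥ y) i
·ᵥ-cong A x≗y i = ∑-cong (λ j → cong (A i j *_) (x≗y j))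

·ᵥ-assoc : ∀ {m n k} (A : Mat m n) (B : Mat n k) x i → ((A · B) ·ᵥ x) i ≡ (A ·ᵥ (B ·ᵥ x)) i
·ᵥ-assoc A B x i = begin
  ∑ (λ l → ∑ (λ k → A i k * B k l) * x l)  ≡⟨ ∑-cong (λ l → ∑-*ʳ (x l) (λ k → A i k * B k l)) ⟩
  ∑ (λ l → ∑ (λ k → A i k * B k l * x l))  ≡⟨ ∑-comm (λ l k → A i k * B k l * x l) ⟩
  ∑ (λ k → ∑ (λ l → A i k * B k l * x l))  ≡⟨ ∑-cong (λ k → trans (∑-cong (λ l → *-assoc (A i k) (B k l) (x l))) (sym (∑-*ˡ (A i k) (λ l → B k l * x l)))) ⟩
  ∑ (λ k → A i k * ∑ (λ l → B k l * x l))  ∎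

I-·ᵥ : ∀ {n} (x : Vector ℚ n) i → (I ·ᵥ x) i ≡ x i
I-·ᵥ x i = ∑-I i x

·ᵥ-*ˡ : ∀ {m n} (A : Mat m n) c (x : Vector ℚ n) i → (A ·ᵥ (λ j → c * x j)) i ≡ c * (A ·ᵥ x) i
·ᵥ-*ˡ A c x i = trans (∑-cong (λ j → solve 3 (λ a c x → a :* (c :* x) := c :* (a :* x)) refl (A i j) c (x j)))
                      (sym (∑-*ˡ c (λ j → A i j * x j)))

·ᵥ-- : ∀ {m n} (A : Mat m n) (x y : Vector ℚ n) i → (A ·ᵥ (λ j → x j - y j)) i ≡ (A ·ᵥ x) i - (A ·ᵥ y) i
·ᵥ-- A x y i = trans (∑-cong (λ j → solve 3 (λ a x y → a :* (x :- y) := a :* x :- a :* y) refl (A i j) (x j) (y j)))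
                     (∑-- (λ j → A i j * x j) (λ j → A i j * y j))

diagonal-·ᵥ : ∀ {n} {D : Mat n n} → IsDiagonal D → ∀ x i → (D ·ᵥ x) i ≡ D i i * x i
diagonal-·ᵥ {D = D} D-diag x i = ∑-single i (λ j → D i j * x j) D≗0
  where
  D≗0 : ∀ j → j ≢ i → D i j * x j ≡ 0ℚ
  D≗0 j j≢i = trans (cong (_* x j) (D-diag i j (λ i≡j → j≢i (sym i≡j)))) (*-zeroˡ (x j))

∑-·ᵥ : ∀ {m n} (y : Vector ℚ m) (A : Mat m n) (α : Vector ℚ n) → ∑ (λ u → y u * (A ·ᵥ α) u) ≡ ∑ (λ c → α c * (y ᵥ· A) c)
∑-·ᵥ y A α = begin
  ∑ (λ u → y u * (A ·ᵥ α) u)          ≡⟨ ∑-cong (λ u → trans (∑-*ˡ (y u) (λ c → A u c * α c)) (∑-cong (λ c → solve 3 (λ y a x → y :* (a :* x) := x :* (y :* a)) refl (y u) (A u c) (α c)))) ⟩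
  ∑ (λ u → ∑ (λ c → α c * (y u * A u c)))  ≡⟨ ∑-comm (λ u c → α c * (y u * A u c)) ⟩
  ∑ (λ c → ∑ (λ u → α c * (y u * A u c)))  ≡⟨ ∑-cong (λ c → sym (∑-*ˡ (α c) (λ u → y u * A u c))) ⟩
  ∑ (λ c → α c * (y ᵥ· A) c)              ∎

-- Linear algebra

Nontrivial : ∀ {n} → Vector ℚ n → Set
Nontrivial a = ∃ λ j → a j ≢ 0ℚ

∑-insertAt : ∀ {n} (b : Vector ℚ n) k α (h : Vector ℚ (suc n)) →
             ∑ (λ j → insertAt b k α j * h j) ≡ α * h k + ∑ (λ j → b j * h (punchIn k j))
∑-insertAt b k α h = trans (∑-punchIn k (λ j → insertAt b k α j * h j))
  (cong₂ _+_ (cong (_* h k) (insertAt-lookup b k α))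
             (∑-cong (λ j → cong (_* h (punchIn k j)) (insertAt-punchIn b k α j))))

insertAt-nontrivial : ∀ {n} (b : Vector ℚ n) k α → Nontrivial b → Nontrivial (insertAt b k α)
insertAt-nontrivial b k α (j , bj≢0) = punchIn k j , λ eq → bj≢0 (trans (sym (insertAt-punchIn b k α j)) eq)

private
  -- Gaussian elimination of the first column, pivoting on row k.
  module Elimination {m N} (f : Mat (suc N) (suc m)) (k : Fin (suc N)) (pivot≢0 : f k zero ≢ 0ℚ) where
    r : ℚ
    r = 1/_ (f k zero) {{≢-nonZero pivot≢0}}

    eliminated : Mat N m
    eliminated j i = f (punchIn k j) (suc i) - (f (punchIn k j) zero * r) * f k (suc i)

    lift : Vector ℚ N → Vector ℚ (suc N)
    lift b = insertAt b k (- (∑ (λ j → b j * f (punchIn k j) zero) * r))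

    lift-kernel : ∀ b → IsZero (b ᵥ· eliminated) → IsZero (lift b ᵥ· f)
    lift-kernel b b·E≡0 zero = begin
      (lift b ᵥ· f) zero        ≡⟨ ∑-insertAt b k α (λ j → f j zero) ⟩
      α * f k zero + T          ≡⟨ solve 3 (λ T r c → :- (T :* r) :* c :+ T := T :- T :* (r :* c)) refl T r (f k zero) ⟩
      T - T * (r * f k zero)    ≡⟨ cong (λ z → T - T * z) (*-inverseˡ-≢0 (f k zero) pivot≢0) ⟩
      T - T * 1ℚ                ≡⟨ solve 1 (λ T → T :- T :* con 1ℚ := con 0ℚ) refl T ⟩
      0ℚ                        ∎
      where T = ∑ (λ j → b j * f (punchIn k j) zero); α = - (T * r)
    lift-kernel b b·E≡0 (suc i) = begin
      (lift b ᵥ· f) (suc i)     ≡⟨ ∑-insertAt b k α (λ j → f j (suc i)) ⟩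
      α * F + X                 ≡⟨ solve 4 (λ T r F X → :- (T :* r) :* F :+ X := X :- T :* (r :* F)) refl T r F X ⟩
      X - T * (r * F)           ≡⟨ cong (λ z → X - z) (∑-*ʳ (r * F) (λ j → b j * f (punchIn k j) zero)) ⟩
      X - ∑ (λ j → b j * f (punchIn k j) zero * (r * F))
        ≡⟨ sym (∑-- (λ j → b j * f (punchIn k j) (suc i)) (λ j → b j * f (punchIn k j) zero * (r * F))) ⟩
      ∑ (λ j → b j * f (punchIn k j) (suc i) - b j * f (punchIn k j) zero * (r * F))
        ≡⟨ ∑-cong (λ j → solve 5 (λ b x y r F → b :* x :- b :* y :* (r :* F) := b :* (x :- (y :* r) :* F)) refl (b j) (f (punchIn k j) (suc i)) (f (punchIn k j) zero) r F) ⟩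
      (b ᵥ· eliminated) i       ≡⟨ b·E≡0 i ⟩
      0ℚ                        ∎
      where
      T = ∑ (λ j → b j * f (punchIn k j) zero); α = - (T * r)
      F = f k (suc i); X = ∑ (λ j → b j * f (punchIn k j) (suc i))

  zeroColumn-lift : ∀ {m N} (f : Mat (suc N) (suc m)) → (∀ k → f k zero ≡ 0ℚ) →
                    ∀ b → IsZero (b ᵥ· (λ j i → f (suc j) (suc i))) → IsZero (insertAt b zero 0ℚ ᵥ· f)
  zeroColumn-lift f f₀≡0 b b·f≡0 zero =
    trans (cong₂ _+_ (*-zeroˡ (f zero zero)) (∑-zero (λ j → trans (cong (b j *_) (f₀≡0 (suc j))) (*-zeroʳ (b j)))))
          (+-identityˡ 0ℚ)
  zeroColumn-lift f f₀≡0 b b·f≡0 (suc i) = trans (cong₂ _+_ (*-zeroˡ (f zero (suc i))) (b·f≡0 i)) (+-identityˡ 0ℚ)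

excess⇒linearlyDependent : ∀ m N → m ≤ N → (f : Mat (suc N) m) → ∃ λ a → Nontrivial a × IsZero (a ᵥ· f)
excess⇒linearlyDependent zero N _ f = (λ _ → 1ℚ) , (zero , λ ()) , λ ()
excess⇒linearlyDependent (suc m) (suc N) (s≤s m≤N) f with Fin.all? (λ k → f k zero ≟ 0ℚ)
... | yes f₀≡0 =
  let b , b≢0 , b·f≡0 = excess⇒linearlyDependent m N m≤N (λ j i → f (suc j) (suc i))
  in insertAt b zero 0ℚ , insertAt-nontrivial b zero 0ℚ b≢0 , zeroColumn-lift f f₀≡0 b b·f≡0
... | no ¬f₀≡0 =
  let k , pivot≢0 = Fin.¬∀⟶∃¬ _ _ (λ k → f k zero ≟ 0ℚ) ¬f₀≡0
      open Elimination f k pivot≢0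
      b , b≢0 , b·E≡0 = excess⇒linearlyDependent m N m≤N eliminated
  in lift b , insertAt-nontrivial b k _ b≢0 , lift-kernel b b·E≡0

TrivialKernel : ∀ {m n} → Mat m n → Set
TrivialKernel A = ∀ x → IsZero (A ·ᵥ x) → IsZero x

trivialKernel⇒surjective : ∀ {n} (A : Mat n n) → TrivialKernel A → ∀ (y : Vector ℚ n) → ∃ λ (x : Vector ℚ n) → ∀ i → (A ·ᵥ x) i ≡ y i
trivialKernel⇒surjective {n} A ker y with excess⇒linearlyDependent n n ℕ.≤-refl (λ { zero i → y i ; (suc c) i → A i c })
... | a , a≢0 , a·f≡0 with a zero ≟ 0ℚ
...   | yes a₀≡0 = ⊥-elim (proj₂ a≢0 (a≡0 (proj₁ a≢0)))
  where
  A·a≡0 : IsZero (A ·ᵥ (λ c → a (suc c)))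
  A·a≡0 i = begin
    ∑ (λ c → A i c * a (suc c))                     ≡⟨ ∑-cong (λ c → *-comm (A i c) (a (suc c))) ⟩
    ∑ (λ c → a (suc c) * A i c)                     ≡⟨ sym (+-identityˡ _) ⟩
    0ℚ + ∑ (λ c → a (suc c) * A i c)                ≡⟨ cong (_+ ∑ (λ c → a (suc c) * A i c)) (sym (trans (cong (_* y i) a₀≡0) (*-zeroˡ (y i)))) ⟩
    a zero * y i + ∑ (λ c → a (suc c) * A i c)      ≡⟨ a·f≡0 i ⟩
    0ℚ                                              ∎
  a≡0 : IsZero a
  a≡0 zero    = a₀≡0
  a≡0 (suc c) = ker (λ c → a (suc c)) A·a≡0 c
...   | no a₀≢0 = x , A·x≡y
  where
  r = 1/_ (a zero) {{≢-nonZero a₀≢0}}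
  x : Vector ℚ n
  x c = - (a (suc c) * r)
  S : Vector ℚ n
  S i = ∑ (λ c → a (suc c) * A i c)
  A·x≡y : ∀ i → (A ·ᵥ x) i ≡ y i
  A·x≡y i = begin
    ∑ (λ c → A i c * - (a (suc c) * r))   ≡⟨ ∑-cong (λ c → solve 3 (λ A a r → A :* (:- (a :* r)) := (:- r) :* (a :* A)) refl (A i c) (a (suc c)) r) ⟩
    ∑ (λ c → (- r) * (a (suc c) * A i c)) ≡⟨ sym (∑-*ˡ (- r) (λ c → a (suc c) * A i c)) ⟩
    (- r) * S i                           ≡⟨ cong ((- r) *_) (x+y≡0⇒y≡-x {a zero * y i} {S i} (a·f≡0 i)) ⟩
    (- r) * (- (a zero * y i))            ≡⟨ solve 3 (λ r a y → (:- r) :* (:- (a :* y)) := (r :* a) :* y) refl r (a zero) (y i) ⟩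
    (r * a zero) * y i                    ≡⟨ cong (_* y i) (*-inverseˡ-≢0 (a zero) a₀≢0) ⟩
    1ℚ * y i                              ≡⟨ *-identityˡ (y i) ⟩
    y i                                   ∎

trivialKernel⇒invertible : ∀ {n} (A : Mat n n) → TrivialKernel A → ∃ λ (B : Mat n n) → IsInverse B A
trivialKernel⇒invertible {n} A ker = B , B·A≡I , A·B≡I
  where
  B : Mat n n
  B c j = proj₁ (trivialKernel⇒surjective A ker (λ i → I i j)) c
  A·B≡I : ∀ i j → (A · B) i j ≡ I i j
  A·B≡I i j = proj₂ (trivialKernel⇒surjective A ker (λ i → I i j)) i
  -- A (B A - I) = (A B) A - A = 0
  B·A≡I : ∀ i j → (B · A) i j ≡ I i j
  B·A≡I c k = x-y≡0⇒x≡y (ker x A·x≡0 c)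
    where
    x : Vector ℚ n
    x c = (B · A) c k - I c k
    A·x≡0 : IsZero (A ·ᵥ x)
    A·x≡0 i = begin
      (A ·ᵥ x) i                          ≡⟨ ·ᵥ-- A (λ c → (B · A) c k) (λ c → I c k) i ⟩
      (A · (B · A)) i k - (A · I) i k     ≡⟨ cong₂ _-_ (sym (·-assoc A B A i k)) (·-I A i k) ⟩
      ((A · B) · A) i k - A i k           ≡⟨ cong (_- A i k) (trans (∑-cong (λ l → cong (_* A l k) (A·B≡I i l))) (I-· A i k)) ⟩
      A i k - A i k                       ≡⟨ +-inverseʳ (A i k) ⟩
      0ℚ                                  ∎

dependentRow-redundant : ∀ {m n} (A : Mat (suc m) n) (a : Vector ℚ (suc m)) k → a k ≢ 0ℚ → IsZero (a ᵥ· A) →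
                         ∀ x → (∀ r → (A ·ᵥ x) (punchIn k r) ≡ 0ℚ) → IsZero (A ·ᵥ x)
dependentRow-redundant A a k aₖ≢0 a·A≡0 x Ax≡0 j with k Fin.≟ j
... | no k≢j   = subst (λ z → (A ·ᵥ x) z ≡ 0ℚ) (Fin.punchIn-punchOut k≢j) (Ax≡0 (punchOut k≢j))
... | yes refl = c*x≡0⇒x≡0 (a k) aₖ≢0 (begin
  a k * (A ·ᵥ x) k                                       ≡⟨ sym (+-identityʳ _) ⟩
  a k * (A ·ᵥ x) k + 0ℚ                                  ≡⟨ cong (a k * (A ·ᵥ x) k +_) (sym (∑-zero (λ r → trans (cong (a (punchIn k r) *_) (Ax≡0 r)) (*-zeroʳ (a (punchIn k r)))))) ⟩
  a k * (A ·ᵥ x) k + ∑ (λ r → a (punchIn k r) * (A ·ᵥ x) (punchIn k r))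
                                                         ≡⟨ sym (∑-punchIn k (λ j → a j * (A ·ᵥ x) j)) ⟩
  ∑ (λ j → a j * (A ·ᵥ x) j)                             ≡⟨ ∑-·ᵥ a A x ⟩
  ∑ (λ i → x i * (a ᵥ· A) i)                             ≡⟨ ∑-zero (λ i → trans (cong (x i *_) (a·A≡0 i)) (*-zeroʳ (x i))) ⟩
  0ℚ                                                     ∎)

InSpan : ∀ {n} → Vector ℚ n → Vector ℚ n → Set
InSpan x v = ∃ λ (c : ℚ) → ∀ i → x i ≡ c * v i

kernel⊆span⇒rowsIndependent : ∀ m (M : Mat (suc m) (suc (suc m))) (v : Vector ℚ (suc (suc m))) → v zero ≢ 0ℚ →
  (∀ x → IsZero (M ·ᵥ x) → InSpan x v) → ∀ b → IsZero (b ᵥ· M) → IsZero b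
kernel⊆span⇒rowsIndependent m M v v₀≢0 ker⊆span b b·M≡0 k with b k ≟ 0ℚ
... | yes bₖ≡0 = bₖ≡0
... | no bₖ≢0 = ⊥-elim (a≢0 (a≡0 j))
  where
  -- a vector with x₀ = 0 killed by every row but the k-th exists by counting dimensions
  dep = excess⇒linearlyDependent m m ℕ.≤-refl (λ j r → M (punchIn k r) (suc j))
  a = proj₁ dep
  j = proj₁ (proj₁ (proj₂ dep))
  a≢0 = proj₂ (proj₁ (proj₂ dep))
  x : Vector ℚ (suc (suc m))
  x = insertAt a zero 0ℚ
  Mx≡0 : ∀ r → (M ·ᵥ x) (punchIn k r) ≡ 0ℚ
  Mx≡0 r = begin
    (M ·ᵥ x) (punchIn k r)                          ≡⟨ cong (_+ ∑ (λ j → M (punchIn k r) (suc j) * a j)) (*-zeroʳ (M (punchIn k r) zero)) ⟩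
    0ℚ + ∑ (λ j → M (punchIn k r) (suc j) * a j)    ≡⟨ +-identityˡ _ ⟩
    ∑ (λ j → M (punchIn k r) (suc j) * a j)         ≡⟨ ∑-cong (λ j → *-comm (M (punchIn k r) (suc j)) (a j)) ⟩
    ∑ (λ j → a j * M (punchIn k r) (suc j))         ≡⟨ proj₂ (proj₂ dep) r ⟩
    0ℚ                                              ∎
  x∈span = ker⊆span x (dependentRow-redundant M b k bₖ≢0 b·M≡0 x Mx≡0)
  c≡0 : proj₁ x∈span ≡ 0ℚ
  c≡0 = c*x≡0⇒x≡0 (v zero) v₀≢0 (trans (*-comm (v zero) _) (sym (proj₂ x∈span zero)))
  a≡0 : IsZero a
  a≡0 j = trans (proj₂ x∈span (suc j)) (trans (cong (_* v (suc j)) c≡0) (*-zeroˡ (v (suc j))))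

record BalancingRows (q : ℕ) (v : Vector ℚ (suc q)) (m : ℕ) : Set where
  field
    rows        : Fin m → Fin (suc q) → Trit
    rows·v≡0    : IsZero (⟦ rows ⟧ ·ᵥ v)
    kernel⊆span : ∀ x → IsZero (⟦ rows ⟧ ·ᵥ x) → InSpan x v

module _ {q} {v : Vector ℚ (suc q)} (v₀≢0 : v zero ≢ 0ℚ) where

  dropDependentRow : ∀ {m} → q ≤ m → BalancingRows q v (suc m) → BalancingRows q v m
  dropDependentRow {m} q≤m R = record
    { rows        = λ j → rows (punchIn k j)
    ; rows·v≡0    = λ j → rows·v≡0 (punchIn k j)
    ; kernel⊆span = λ x Rx≡0 → kernel⊆span x (dependentRow-redundant ⟦ rows ⟧ a k aₖ≢0 a·R≡0 x Rx≡0)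
    }
    where
    open BalancingRows R
    dep = excess⇒linearlyDependent q m q≤m (λ j i → ⟦ rows ⟧ j (suc i))
    a = proj₁ dep
    k = proj₁ (proj₁ (proj₂ dep))
    aₖ≢0 = proj₂ (proj₁ (proj₂ dep))
    -- column 0 of a·R vanishes too, because (a·R)·v = a·(R v) = 0 and v₀ ≠ 0
    a·R≡0 : IsZero (a ᵥ· ⟦ rows ⟧)
    a·R≡0 (suc i) = proj₂ (proj₂ dep) i
    a·R≡0 zero = c*x≡0⇒x≡0 (v zero) v₀≢0 (begin
      v zero * (a ᵥ· ⟦ rows ⟧) zero                                    ≡⟨ sym (+-identityʳ _) ⟩
      v zero * (a ᵥ· ⟦ rows ⟧) zero + 0ℚ                               ≡⟨ cong (v zero * (a ᵥ· ⟦ rows ⟧) zero +_) (sym (∑-zero (λ i → trans (cong (v (suc i) *_) (proj₂ (proj₂ dep) i)) (*-zeroʳ (v (suc i)))))) ⟩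
      ∑ (λ c → v c * (a ᵥ· ⟦ rows ⟧) c)                               ≡⟨ sym (∑-·ᵥ a ⟦ rows ⟧ v) ⟩
      ∑ (λ j → a j * (⟦ rows ⟧ ·ᵥ v) j)                                ≡⟨ ∑-zero (λ j → trans (cong (a j *_) (rows·v≡0 j)) (*-zeroʳ (a j))) ⟩
      0ℚ                                                              ∎)

  shrink : ∀ d → BalancingRows q v (d ℕ.+ q) → BalancingRows q v q
  shrink zero    R = R
  shrink (suc d) R = shrink d (dropDependentRow (ℕ.m≤n+m q d) R)

BalancingRows⇒nullSpaceIsSpan : ∀ {q} {v : Vector ℚ (suc q)} {m} (R : BalancingRows q v m) → NullSpaceIsSpan ⟦ BalancingRows.rows R ⟧ v
BalancingRows⇒nullSpaceIsSpan {v = v} R x = kernel⊆span x , λ { (c , x≡cv) j → begin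
  (⟦ rows ⟧ ·ᵥ x) j                    ≡⟨ ·ᵥ-cong ⟦ rows ⟧ x≡cv j ⟩
  (⟦ rows ⟧ ·ᵥ (λ i → c * v i)) j      ≡⟨ ·ᵥ-*ˡ ⟦ rows ⟧ c v j ⟩
  c * (⟦ rows ⟧ ·ᵥ v) j                ≡⟨ cong (c *_) (rows·v≡0 j) ⟩
  c * 0ℚ                               ≡⟨ *-zeroʳ c ⟩
  0ℚ                                   ∎ }
  where open BalancingRows R

-- The complete multipartite graph

vertex : ∀ p (v : Fin p → ℕ) (i : Fin p) → Fin (v i) → Fin (total p v)
vertex (suc p) v zero    t = t ↑ˡ total p (λ i → v (suc i))
vertex (suc p) v (suc i) t = v zero ↑ʳ vertex p (λ i → v (suc i)) i t

part-vertex : ∀ p v i t → part p v (vertex p v i t) ≡ i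
part-vertex (suc p) v zero t rewrite Fin.splitAt-↑ˡ (v zero) t (total p (λ i → v (suc i))) = refl
part-vertex (suc p) v (suc i) t
  rewrite Fin.splitAt-↑ʳ (v zero) (total p (λ i → v (suc i))) (vertex p (λ i → v (suc i)) i t)
  = cong suc (part-vertex p (λ i → v (suc i)) i t)

vertex-injective : ∀ p v i {t t′ : Fin (v i)} → vertex p v i t ≡ vertex p v i t′ → t ≡ t′
vertex-injective (suc p) v zero    eq = Fin.↑ˡ-injective _ _ _ eq
vertex-injective (suc p) v (suc i) eq = vertex-injective p (λ i → v (suc i)) i (Fin.↑ʳ-injective (v zero) _ _ eq)

vertex-≢ : ∀ p v {i j} (t : Fin (v i)) (s : Fin (v j)) → i ≢ j → vertex p v i t ≢ vertex p v j s
vertex-≢ p v {i} {j} t s i≢j eq = i≢j (trans (sym (part-vertex p v i t)) (trans (cong (part p v) eq) (part-vertex p v j s)))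

I-vertex : ∀ p v i (t s : Fin (v i)) → I (vertex p v i t) (vertex p v i s) ≡ I t s
I-vertex p v i t s with t Fin.≟ s
... | yes refl = I-diag (vertex p v i t)
... | no t≢s   = I-offdiag (λ eq → t≢s (vertex-injective p v i eq))

locate : ∀ p (v : Fin p → ℕ) → Fin (total p v) → Σ (Fin p) (λ i → Fin (v i))
locate (suc p) v x with splitAt (v zero) x
... | inj₁ t = zero , t
... | inj₂ y = let i , t = locate p (λ i → v (suc i)) y in suc i , t

locate-vertex : ∀ p v i t → locate p v (vertex p v i t) ≡ (i , t)
locate-vertex (suc p) v zero t rewrite Fin.splitAt-↑ˡ (v zero) t (total p (λ i → v (suc i))) = refl
locate-vertex (suc p) v (suc i) t
  rewrite Fin.splitAt-↑ʳ (v zero) (total p (λ i → v (suc i))) (vertex p (λ i → v (suc i)) i t)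
        | locate-vertex p (λ i → v (suc i)) i t = refl

vertex-locate : ∀ p v x → let i , t = locate p v x in vertex p v i t ≡ x
vertex-locate (suc p) v x with splitAt (v zero) x in eq
... | inj₁ t = Fin.splitAt⁻¹-↑ˡ eq
... | inj₂ y = trans (cong (v zero ↑ʳ_) (vertex-locate p (λ i → v (suc i)) y)) (Fin.splitAt⁻¹-↑ʳ eq)

∑-vertex : ∀ p v (f : Fin (total p v) → ℚ) → ∑ f ≡ ∑ (λ i → ∑ (λ t → f (vertex p v i t)))
∑-vertex zero    v f = refl
∑-vertex (suc p) v f = trans (∑-splitAt (v zero) (total p (λ i → v (suc i))) f)
  (cong (∑ (λ t → f (t ↑ˡ total p (λ i → v (suc i)))) +_) (∑-vertex p (λ i → v (suc i)) (λ x → f (v zero ↑ʳ x))))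

ℕ→ℚ-total : ∀ p v → ℕ→ℚ (total p v) ≡ ∑ (λ i → ℕ→ℚ (v i))
ℕ→ℚ-total zero    v = refl
ℕ→ℚ-total (suc p) v = trans (ℕ→ℚ-+ (v zero) _) (cong (ℕ→ℚ (v zero) +_) (ℕ→ℚ-total p (λ i → v (suc i))))

total-≥ : ∀ p v → (∀ i → 1 ≤ v i) → p ≤ total p v
total-≥ zero    v v≥1 = z≤n
total-≥ (suc p) v v≥1 = ℕ.+-mono-≤ (v≥1 zero) (total-≥ p (λ i → v (suc i)) (λ i → v≥1 (suc i)))

total-suc : ∀ p (v v′ : Fin p → ℕ) → (∀ i → v i ≡ suc (v′ i)) → total p v ≡ p ℕ.+ total p v′
total-suc zero    v v′ v≡1+v′ = refl
total-suc (suc p) v v′ v≡1+v′ = begin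
  v zero ℕ.+ total p (λ i → v (suc i))      ≡⟨ cong₂ ℕ._+_ (v≡1+v′ zero) (total-suc p (λ i → v (suc i)) (λ i → v′ (suc i)) (λ i → v≡1+v′ (suc i))) ⟩
  suc (v′ zero ℕ.+ (p ℕ.+ T))               ≡⟨ cong suc (trans (sym (ℕ.+-assoc (v′ zero) p T)) (trans (cong (ℕ._+ T) (ℕ.+-comm (v′ zero) p)) (ℕ.+-assoc p (v′ zero) T))) ⟩
  suc (p ℕ.+ (v′ zero ℕ.+ T))               ∎
  where T = total p (λ i → v′ (suc i))

offset : ∀ p (v : Fin p → ℕ) → Fin p → ℕ
offset (suc p) v zero    = 0
offset (suc p) v (suc i) = v zero ℕ.+ offset p (λ i → v (suc i)) i

toℕ-vertex : ∀ p v i t → toℕ (vertex p v i t) ≡ offset p v i ℕ.+ toℕ t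
toℕ-vertex (suc p) v zero    t = Fin.toℕ-↑ˡ t _
toℕ-vertex (suc p) v (suc i) t = trans (Fin.toℕ-↑ʳ (v zero) _)
  (trans (cong (v zero ℕ.+_) (toℕ-vertex p (λ i → v (suc i)) i t)) (sym (ℕ.+-assoc (v zero) _ (toℕ t))))

laplacian-loopless : ∀ {n} (A : Mat n n) → (∀ u → A u u ≡ 0ℚ) → ∀ u w → laplacian A u w ≡ I u w * degree A u - A u w
laplacian-loopless A A-loopless u w with u Fin.≟ w
... | yes refl = cong (_- A u u) (sym (*-identityˡ (degree A u)))
... | no _     = cong (_- A u w) (sym (*-zeroˡ (degree A u)))

module Multipartite (p : ℕ) (v : Fin p → ℕ) where

  n : ℕ
  n = total p v

  nℚ : ℚ
  nℚ = ℕ→ℚ n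

  vℚ : Fin p → ℚ
  vℚ i = ℕ→ℚ (v i)

  L : Mat n n
  L = multipartiteLaplacian p v

  partSum : Vector ℚ n → Fin p → ℚ
  partSum x i = ∑ (λ t → x (vertex p v i t))

  ConstantOnParts : Vector ℚ n → (Fin p → ℚ) → Set
  ConstantOnParts x g = ∀ u → x u ≡ g (part p v u)

  adjacency : ∀ u w → multipartiteAdj p v u w ≡ 1ℚ - I (part p v u) (part p v w)
  adjacency u w with part p v u Fin.≟ part p v w
  ... | yes _ = refl
  ... | no _  = refl

  partSum-constantOnParts : ∀ {x g} → ConstantOnParts x g → ∀ i → partSum x i ≡ vℚ i * g i
  partSum-constantOnParts {x} {g} x≡g i = begin
    ∑ (λ t → x (vertex p v i t))   ≡⟨ ∑-cong (λ t → trans (x≡g (vertex p v i t)) (cong g (part-vertex p v i t))) ⟩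
    ∑ {v i} (λ t → g i)            ≡⟨ ∑-const (v i) (g i) ⟩
    vℚ i * g i                     ∎

  ∑-constantOnParts : ∀ {x g} → ConstantOnParts x g → ∑ x ≡ ∑ (λ i → vℚ i * g i)
  ∑-constantOnParts x≡g = trans (∑-vertex p v _) (∑-cong (partSum-constantOnParts x≡g))

  ∑-I-part : ∀ (x : Vector ℚ n) j → ∑ (λ w → I j (part p v w) * x w) ≡ partSum x j
  ∑-I-part x j = begin
    ∑ (λ w → I j (part p v w) * x w)                         ≡⟨ ∑-vertex p v (λ w → I j (part p v w) * x w) ⟩
    ∑ (λ i → ∑ (λ t → I j (part p v (vx i t)) * x (vx i t)))  ≡⟨ ∑-cong (λ i → ∑-cong (λ t → cong (λ k → I j k * x (vx i t)) (part-vertex p v i t))) ⟩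
    ∑ (λ i → ∑ (λ t → I j i * x (vx i t)))                    ≡⟨ ∑-cong (λ i → sym (∑-*ˡ (I j i) (λ t → x (vx i t)))) ⟩
    ∑ (λ i → I j i * partSum x i)                             ≡⟨ ∑-I j (partSum x) ⟩
    partSum x j                                               ∎
    where vx = vertex p v

  ∑-adjacency : ∀ (x : Vector ℚ n) u → ∑ (λ w → multipartiteAdj p v u w * x w) ≡ ∑ x - partSum x (part p v u)
  ∑-adjacency x u = begin
    ∑ (λ w → multipartiteAdj p v u w * x w)      ≡⟨ ∑-cong (λ w → trans (cong (_* x w) (adjacency u w)) (solve 2 (λ b x → (con 1ℚ :- b) :* x := x :- b :* x) refl (I (part p v u) (part p v w)) (x w))) ⟩
    ∑ (λ w → x w - I (part p v u) (part p v w) * x w)  ≡⟨ ∑-- x (λ w → I (part p v u) (part p v w) * x w) ⟩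
    ∑ x - ∑ (λ w → I (part p v u) (part p v w) * x w)  ≡⟨ cong (λ z → ∑ x - z) (∑-I-part x (part p v u)) ⟩
    ∑ x - partSum x (part p v u)                       ∎

  degree-multipartite : ∀ u → degree (multipartiteAdj p v) u ≡ nℚ - vℚ (part p v u)
  degree-multipartite u = begin
    ∑ (λ w → multipartiteAdj p v u w)           ≡⟨ ∑-cong (λ w → sym (*-identityʳ (multipartiteAdj p v u w))) ⟩
    ∑ (λ w → multipartiteAdj p v u w * 1ℚ)      ≡⟨ ∑-adjacency (λ _ → 1ℚ) u ⟩
    ∑ {n} (λ _ → 1ℚ) - ∑ {v (part p v u)} (λ _ → 1ℚ) ≡⟨ cong₂ _-_ (∑-1 n) (∑-1 (v (part p v u))) ⟩
    nℚ - vℚ (part p v u)                        ∎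

  L-·ᵥ : ∀ (x : Vector ℚ n) u → (L ·ᵥ x) u ≡ (nℚ - vℚ (part p v u)) * x u - (∑ x - partSum x (part p v u))
  L-·ᵥ x u = begin
    ∑ (λ w → L u w * x w)                       ≡⟨ ∑-cong (λ w → trans (cong (_* x w) (L-entry w)) (solve 4 (λ i d a x → (i :* d :- a) :* x := i :* (d :* x) :- a :* x) refl (I u w) d (multipartiteAdj p v u w) (x w))) ⟩
    ∑ (λ w → I u w * (d * x w) - multipartiteAdj p v u w * x w)
                                                ≡⟨ ∑-- (λ w → I u w * (d * x w)) (λ w → multipartiteAdj p v u w * x w) ⟩
    ∑ (λ w → I u w * (d * x w)) - ∑ (λ w → multipartiteAdj p v u w * x w)
                                                ≡⟨ cong₂ _-_ (∑-I u (λ w → d * x w)) (∑-adjacency x u) ⟩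
    d * x u - (∑ x - partSum x (part p v u))    ∎
    where
    d = nℚ - vℚ (part p v u)
    adj-loopless : ∀ u → multipartiteAdj p v u u ≡ 0ℚ
    adj-loopless u = trans (adjacency u u) (cong (λ z → 1ℚ - z) (I-diag (part p v u)))
    L-entry : ∀ w → L u w ≡ I u w * d - multipartiteAdj p v u w
    L-entry w = trans (laplacian-loopless (multipartiteAdj p v) adj-loopless u w)
                      (cong (λ z → I u w * z - multipartiteAdj p v u w) (degree-multipartite u))

  constantOnParts⇒eigen-n : ∀ {x g} → ConstantOnParts x g → ∑ (λ i → vℚ i * g i) ≡ 0ℚ → ∀ u → (L ·ᵥ x) u ≡ nℚ * x u
  constantOnParts⇒eigen-n {x} {g} x≡g ∑vg≡0 u = begin
    (L ·ᵥ x) u                                          ≡⟨ L-·ᵥ x u ⟩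
    (nℚ - vᵤ) * x u - (∑ x - partSum x (part p v u))    ≡⟨ cong₂ (λ a b → (nℚ - vᵤ) * x u - (a - b)) (trans (∑-constantOnParts x≡g) ∑vg≡0) partSumᵤ ⟩
    (nℚ - vᵤ) * x u - (0ℚ - vᵤ * x u)                   ≡⟨ solve 3 (λ n v x → (n :- v) :* x :- (con 0ℚ :- v :* x) := n :* x) refl nℚ vᵤ (x u) ⟩
    nℚ * x u                                            ∎
    where
    vᵤ = vℚ (part p v u)
    partSumᵤ : partSum x (part p v u) ≡ vᵤ * x u
    partSumᵤ = trans (partSum-constantOnParts {x} {g} x≡g (part p v u)) (cong (vᵤ *_) (sym (x≡g u)))

  zeroPartSums⇒eigen : ∀ (x : Vector ℚ n) i → IsZero (partSum x) → (∀ u → part p v u ≢ i → x u ≡ 0ℚ) →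
                       ∀ u → (L ·ᵥ x) u ≡ (nℚ - vℚ i) * x u
  zeroPartSums⇒eigen x i partSum≡0 x≡0-outside u = begin
    (L ·ᵥ x) u                                               ≡⟨ L-·ᵥ x u ⟩
    (nℚ - vℚ (part p v u)) * x u - (∑ x - partSum x (part p v u))
      ≡⟨ cong₂ (λ a b → (nℚ - vℚ (part p v u)) * x u - (a - b)) (trans (∑-vertex p v x) (∑-zero partSum≡0)) (partSum≡0 (part p v u)) ⟩
    (nℚ - vℚ (part p v u)) * x u - (0ℚ - 0ℚ)                 ≡⟨ solve 2 (λ d x → d :* x :- (con 0ℚ :- con 0ℚ) := d :* x) refl (nℚ - vℚ (part p v u)) (x u) ⟩
    (nℚ - vℚ (part p v u)) * x u                             ≡⟨ same-eigenvalue (part p v u Fin.≟ i) ⟩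
    (nℚ - vℚ i) * x u                                        ∎
    where
    same-eigenvalue : Dec (part p v u ≡ i) → (nℚ - vℚ (part p v u)) * x u ≡ (nℚ - vℚ i) * x u
    same-eigenvalue (yes refl) = refl
    same-eigenvalue (no uᵢ≢i)  = begin
      (nℚ - vℚ (part p v u)) * x u   ≡⟨ cong ((nℚ - vℚ (part p v u)) *_) (x≡0-outside u uᵢ≢i) ⟩
      (nℚ - vℚ (part p v u)) * 0ℚ    ≡⟨ *-zeroʳ (nℚ - vℚ (part p v u)) ⟩
      0ℚ                             ≡⟨ sym (*-zeroʳ (nℚ - vℚ i)) ⟩
      (nℚ - vℚ i) * 0ℚ               ≡⟨ cong ((nℚ - vℚ i) *_) (sym (x≡0-outside u uᵢ≢i)) ⟩
      (nℚ - vℚ i) * x u              ∎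

  module _ (v≥1 : ∀ i → 1 ≤ v i) where

    vℚ≢0 : ∀ i → vℚ i ≢ 0ℚ
    vℚ≢0 i = ℕ→ℚ-≢0 (v≥1 i)

    representative : Fin p → Fin n
    representative i = vertex p v i (Fin.fromℕ< (v≥1 i))

    part-representative : ∀ i → part p v (representative i) ≡ i
    part-representative i = part-vertex p v i _

    -- (L x)ᵤ = n xᵤ forces v_{part u} xᵤ = Σ_{part u} x - Σ x, and summing over one part gives Σ x = 0.
    eigen-n⇒constantOnParts : Fin p → ∀ x → (∀ u → (L ·ᵥ x) u ≡ nℚ * x u) →
      let g i = x (representative i) in ConstantOnParts x g × ∑ (λ i → vℚ i * g i) ≡ 0ℚ
    eigen-n⇒constantOnParts i₀ x Lx≡nx = x≡g , trans (sym (∑-constantOnParts {x} {g} x≡g)) ∑x≡0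
      where
      g : Fin p → ℚ
      g i = x (representative i)
      vx≡S-∑x : ∀ u → vℚ (part p v u) * x u ≡ partSum x (part p v u) - ∑ x
      vx≡S-∑x u = x-y≡0⇒x≡y (begin
        vᵤ * x u - (partSum x (part p v u) - ∑ x)
          ≡⟨ solve 5 (λ n v x s t → v :* x :- (s :- t) := n :* x :- ((n :- v) :* x :- (t :- s))) refl nℚ vᵤ (x u) (partSum x (part p v u)) (∑ x) ⟩
        nℚ * x u - ((nℚ - vᵤ) * x u - (∑ x - partSum x (part p v u)))
          ≡⟨ cong (λ z → nℚ * x u - z) (sym (L-·ᵥ x u)) ⟩
        nℚ * x u - (L ·ᵥ x) u                 ≡⟨ cong (λ z → nℚ * x u - z) (Lx≡nx u) ⟩
        nℚ * x u - nℚ * x u                   ≡⟨ +-inverseʳ (nℚ * x u) ⟩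
        0ℚ                                    ∎)
        where vᵤ = vℚ (part p v u)
      ∑x≡0 : ∑ x ≡ 0ℚ
      ∑x≡0 = begin
        ∑ x           ≡⟨ solve 2 (λ a s → s := a :- (a :- s)) refl S (∑ x) ⟩
        S - (S - ∑ x) ≡⟨ cong (λ z → S - z) (sym (*-cancelˡ-≢0 (vℚ i₀) (vℚ≢0 i₀) vS≡vS-v∑x)) ⟩
        S - S         ≡⟨ +-inverseʳ S ⟩
        0ℚ            ∎
        where
        S = partSum x i₀
        vS≡vS-v∑x : vℚ i₀ * S ≡ vℚ i₀ * (S - ∑ x)
        vS≡vS-v∑x = begin
          vℚ i₀ * S                                ≡⟨ ∑-*ˡ (vℚ i₀) (λ t → x (vertex p v i₀ t)) ⟩
          ∑ (λ t → vℚ i₀ * x (vertex p v i₀ t))    ≡⟨ ∑-cong (λ t → subst (λ j → vℚ j * x (vertex p v i₀ t) ≡ partSum x j - ∑ x) (part-vertex p v i₀ t) (vx≡S-∑x (vertex p v i₀ t))) ⟩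
          ∑ {v i₀} (λ t → S - ∑ x)                 ≡⟨ ∑-const (v i₀) (S - ∑ x) ⟩
          vℚ i₀ * (S - ∑ x)                        ∎
      vx≡S : ∀ u → vℚ (part p v u) * x u ≡ partSum x (part p v u)
      vx≡S u = trans (vx≡S-∑x u) (trans (cong (λ z → partSum x (part p v u) - z) ∑x≡0) (+-identityʳ _))
      x≡g : ConstantOnParts x g
      x≡g u = *-cancelˡ-≢0 (vℚ (part p v u)) (vℚ≢0 (part p v u)) (trans (vx≡S u)
        (sym (subst (λ j → vℚ j * g (part p v u) ≡ partSum x j) (part-representative (part p v u)) (vx≡S (representative (part p v u))))))

-- Only if

module DiagonalizableToBalanced (q : ℕ) (v : Fin (suc q) → ℕ) (v≥1 : ∀ i → 1 ≤ v i)
  (P : Fin (total (suc q) v) → Fin (total (suc q) v) → Trit) (P-diag : Diagonalizes (multipartiteLaplacian (suc q) v) P) where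

  open Multipartite (suc q) v

  private
    Q = proj₁ P-diag
    P·Q≡I = proj₂ (proj₁ (proj₂ P-diag))
    D-diagonal = proj₂ (proj₂ P-diag)

  D : Mat n n
  D = Q · (L · ⟦ P ⟧)

  d : Vector ℚ n
  d c = D c c

  L·P≡P·d : ∀ u c → (L · ⟦ P ⟧) u c ≡ ⟦ P ⟧ u c * d c
  L·P≡P·d u c = begin
    (L · ⟦ P ⟧) u c                 ≡⟨ sym (I-· (L · ⟦ P ⟧) u c) ⟩
    (I · (L · ⟦ P ⟧)) u c           ≡⟨ ∑-cong (λ l → cong (_* (L · ⟦ P ⟧) l c) (sym (P·Q≡I u l))) ⟩
    ((⟦ P ⟧ · Q) · (L · ⟦ P ⟧)) u c ≡⟨ ·-assoc ⟦ P ⟧ Q (L · ⟦ P ⟧) u c ⟩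
    (⟦ P ⟧ · D) u c                 ≡⟨ ·-diagonal ⟦ P ⟧ D-diagonal u c ⟩
    ⟦ P ⟧ u c * d c                 ∎

  eigenvector⇒eigencolumnCombination : ∀ λ′ (w : Vector ℚ n) → (∀ u → (L ·ᵥ w) u ≡ λ′ * w u) →
    ∃ λ (α : Vector ℚ n) → (∀ u → (⟦ P ⟧ ·ᵥ α) u ≡ w u) × (∀ c → d c ≢ λ′ → α c ≡ 0ℚ)
  eigenvector⇒eigencolumnCombination λ′ w Lw≡λw = α , P·α≡w , α≡0
    where
    α = Q ·ᵥ w
    P·α≡w : ∀ u → (⟦ P ⟧ ·ᵥ α) u ≡ w u
    P·α≡w u = trans (sym (·ᵥ-assoc ⟦ P ⟧ Q w u)) (trans (∑-cong (λ l → cong (_* w l) (P·Q≡I u l))) (I-·ᵥ w u))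
    dα≡λα : ∀ c → d c * α c ≡ λ′ * α c
    dα≡λα c = begin
      d c * α c                        ≡⟨ sym (diagonal-·ᵥ D-diagonal α c) ⟩
      (D ·ᵥ α) c                       ≡⟨ ·ᵥ-assoc Q (L · ⟦ P ⟧) α c ⟩
      (Q ·ᵥ ((L · ⟦ P ⟧) ·ᵥ α)) c      ≡⟨ ·ᵥ-cong Q (λ u → trans (·ᵥ-assoc L ⟦ P ⟧ α u) (trans (·ᵥ-cong L P·α≡w u) (Lw≡λw u))) c ⟩
      (Q ·ᵥ (λ u → λ′ * w u)) c        ≡⟨ ·ᵥ-*ˡ Q λ′ w c ⟩
      λ′ * α c                         ∎
    α≡0 : ∀ c → d c ≢ λ′ → α c ≡ 0ℚ
    α≡0 c dc≢λ = c*x≡0⇒x≡0 (d c - λ′) (λ dc-λ≡0 → dc≢λ (x-y≡0⇒x≡y dc-λ≡0)) (begin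
      (d c - λ′) * α c           ≡⟨ solve 3 (λ d l a → (d :- l) :* a := d :* a :- l :* a) refl (d c) λ′ (α c) ⟩
      d c * α c - λ′ * α c       ≡⟨ cong (_- λ′ * α c) (dα≡λα c) ⟩
      λ′ * α c - λ′ * α c        ≡⟨ +-inverseʳ (λ′ * α c) ⟩
      0ℚ                         ∎)

  R : Fin n → Fin (suc q) → Trit
  R c i with d c ≟ nℚ
  ... | yes _ = P (representative v≥1 i) c
  ... | no _  = zer

  R-eigencolumn : ∀ c i → d c ≡ nℚ → ⟦ R ⟧ c i ≡ ⟦ P ⟧ (representative v≥1 i) c
  R-eigencolumn c i dc≡n with d c ≟ nℚ
  ... | yes _    = refl
  ... | no dc≢n  = ⊥-elim (dc≢n dc≡n)

  R-other : ∀ c i → d c ≢ nℚ → ⟦ R ⟧ c i ≡ 0ℚ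
  R-other c i dc≢n with d c ≟ nℚ
  ... | yes dc≡n = ⊥-elim (dc≢n dc≡n)
  ... | no _     = refl

  column-n-structure : ∀ c → d c ≡ nℚ →
    let g i = ⟦ P ⟧ (representative v≥1 i) c in ConstantOnParts (λ u → ⟦ P ⟧ u c) g × ∑ (λ i → vℚ i * g i) ≡ 0ℚ
  column-n-structure c dc≡n = eigen-n⇒constantOnParts v≥1 zero (λ u → ⟦ P ⟧ u c)
    (λ u → trans (L·P≡P·d u c) (trans (cong (⟦ P ⟧ u c *_) dc≡n) (*-comm (⟦ P ⟧ u c) nℚ)))

  R·v≡0 : IsZero (⟦ R ⟧ ·ᵥ vℚ)
  R·v≡0 c = by-eigenvalue (d c ≟ nℚ)
    where
    by-eigenvalue : Dec (d c ≡ nℚ) → (⟦ R ⟧ ·ᵥ vℚ) c ≡ 0ℚ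
    by-eigenvalue (yes dc≡n) = trans (∑-cong (λ i → trans (cong (_* vℚ i) (R-eigencolumn c i dc≡n)) (*-comm (⟦ P ⟧ (representative v≥1 i) c) (vℚ i))))
                                     (proj₂ (column-n-structure c dc≡n))
    by-eigenvalue (no dc≢n)  = ∑-zero (λ i → trans (cong (_* vℚ i) (R-other c i dc≢n)) (*-zeroˡ (vℚ i)))

  module _ (x : Vector ℚ (suc q)) (R·x≡0 : IsZero (⟦ R ⟧ ·ᵥ x)) where

    private
      v⁻¹ : Fin (suc q) → ℚ
      v⁻¹ i = 1/_ (vℚ i) {{≢-nonZero (vℚ≢0 v≥1 i)}}

      v*[a*v⁻¹]≡a : ∀ i a → vℚ i * (a * v⁻¹ i) ≡ a
      v*[a*v⁻¹]≡a i a = begin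
        vℚ i * (a * v⁻¹ i)   ≡⟨ solve 3 (λ v a r → v :* (a :* r) := a :* (r :* v)) refl (vℚ i) a (v⁻¹ i) ⟩
        a * (v⁻¹ i * vℚ i)   ≡⟨ cong (a *_) (*-inverseˡ-≢0 (vℚ i) (vℚ≢0 v≥1 i)) ⟩
        a * 1ℚ               ≡⟨ *-identityʳ a ⟩
        a                    ∎

      -- x spread evenly over the vertices of each part
      y : Vector ℚ n
      y u = x (part (suc q) v u) * v⁻¹ (part (suc q) v u)

      ∑-y : ∀ (h : Fin (suc q) → ℚ) → ∑ (λ u → y u * h (part (suc q) v u)) ≡ ∑ (λ j → x j * h j)
      ∑-y h = trans (∑-constantOnParts {g = λ j → x j * v⁻¹ j * h j} (λ u → refl))
                    (∑-cong (λ j → trans (cong (vℚ j *_) (solve 3 (λ x r h → x :* r :* h := (x :* h) :* r) refl (x j) (v⁻¹ j) (h j)))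
                                         (v*[a*v⁻¹]≡a j (x j * h j))))

      y·P≡0 : ∀ c → d c ≡ nℚ → (y ᵥ· ⟦ P ⟧) c ≡ 0ℚ
      y·P≡0 c dc≡n = begin
        ∑ (λ u → y u * ⟦ P ⟧ u c)                    ≡⟨ ∑-cong (λ u → cong (y u *_) (proj₁ (column-n-structure c dc≡n) u)) ⟩
        ∑ (λ u → y u * g (part (suc q) v u))         ≡⟨ ∑-y g ⟩
        ∑ (λ j → x j * g j)                          ≡⟨ ∑-cong (λ j → trans (*-comm (x j) (g j)) (cong (_* x j) (sym (R-eigencolumn c j dc≡n)))) ⟩
        (⟦ R ⟧ ·ᵥ x) c                               ≡⟨ R·x≡0 c ⟩
        0ℚ                                           ∎
        where g = λ i → ⟦ P ⟧ (representative v≥1 i) c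

      -- test x against the n-eigenvector vₖ eᵢ - vᵢ eₖ, lifted to the vertices
      module _ (i k : Fin (suc q)) where

        W : Fin (suc q) → ℚ
        W j = I i j * vℚ k - I k j * vℚ i

        W-eigen : ∀ u → (L ·ᵥ (λ w → W (part (suc q) v w))) u ≡ nℚ * W (part (suc q) v u)
        W-eigen = constantOnParts⇒eigen-n {g = W} (λ u → refl) (begin
          ∑ (λ j → vℚ j * W j)        ≡⟨ ∑-I-antisym vℚ vℚ i k ⟩
          vℚ i * vℚ k - vℚ k * vℚ i   ≡⟨ solve 2 (λ a b → a :* b :- b :* a := con 0ℚ) refl (vℚ i) (vℚ k) ⟩
          0ℚ                          ∎)

        y·W≡0 : ∑ (λ u → y u * W (part (suc q) v u)) ≡ 0ℚ
        y·W≡0 = begin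
          ∑ (λ u → y u * W (part (suc q) v u))  ≡⟨ ∑-cong (λ u → cong (y u *_) (sym (P·α≡W u))) ⟩
          ∑ (λ u → y u * (⟦ P ⟧ ·ᵥ α) u)        ≡⟨ ∑-·ᵥ y ⟦ P ⟧ α ⟩
          ∑ (λ c → α c * (y ᵥ· ⟦ P ⟧) c)        ≡⟨ ∑-zero term≡0 ⟩
          0ℚ                                    ∎
          where
          combination = eigenvector⇒eigencolumnCombination nℚ (λ u → W (part (suc q) v u)) W-eigen
          α = proj₁ combination
          P·α≡W = proj₁ (proj₂ combination)
          term≡0 : ∀ c → α c * (y ᵥ· ⟦ P ⟧) c ≡ 0ℚ
          term≡0 c with d c ≟ nℚ
          ... | yes dc≡n = trans (cong (α c *_) (y·P≡0 c dc≡n)) (*-zeroʳ (α c))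
          ... | no dc≢n  = trans (cong (_* (y ᵥ· ⟦ P ⟧) c) (proj₂ (proj₂ combination) c dc≢n)) (*-zeroˡ ((y ᵥ· ⟦ P ⟧) c))

      cross-ratio : ∀ i k → x i * vℚ k ≡ x k * vℚ i
      cross-ratio i k = x-y≡0⇒x≡y (begin
        x i * vℚ k - x k * vℚ i                 ≡⟨ sym (∑-I-antisym x vℚ i k) ⟩
        ∑ (λ j → x j * W i k j)                 ≡⟨ sym (∑-y (W i k)) ⟩
        ∑ (λ u → y u * W i k (part (suc q) v u)) ≡⟨ y·W≡0 i k ⟩
        0ℚ                                      ∎)

    R-kernel⊆span : InSpan x vℚ
    R-kernel⊆span = x zero * v⁻¹ zero , λ i → *-cancelˡ-≢0 (vℚ zero) (vℚ≢0 v≥1 zero) (begin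
      vℚ zero * x i                           ≡⟨ *-comm (vℚ zero) (x i) ⟩
      x i * vℚ zero                           ≡⟨ sym (cross-ratio zero i) ⟩
      x zero * vℚ i                           ≡⟨ sym (v*[a*v⁻¹]≡a zero (x zero * vℚ i)) ⟩
      vℚ zero * (x zero * vℚ i * v⁻¹ zero)    ≡⟨ cong (vℚ zero *_) (solve 3 (λ x v r → x :* v :* r := x :* r :* v) refl (x zero) (vℚ i) (v⁻¹ zero)) ⟩
      vℚ zero * (x zero * v⁻¹ zero * vℚ i)    ∎)

  balancingRows : BalancingRows q vℚ n
  balancingRows = record { rows = R ; rows·v≡0 = R·v≡0 ; kernel⊆span = R-kernel⊆span }

diagonalizable⇒balanced : ∀ q (v : Fin (suc q) → ℕ) → (∀ i → 1 ≤ v i) →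
  TritDiagonalizable (multipartiteLaplacian (suc q) v) → Balanced (suc q) (λ i → ℕ→ℚ (v i))
diagonalizable⇒balanced zero    v v≥1 _ = ℕ→ℚ-≢0 (v≥1 zero)
diagonalizable⇒balanced (suc q) v v≥1 (P , P-diag) = BalancingRows.rows R , BalancingRows⇒nullSpaceIsSpan R
  where
  open Multipartite (suc (suc q)) v using (n; vℚ)
  n≡[n∸q]+q : n ≡ (n ∸ suc q) ℕ.+ suc q
  n≡[n∸q]+q = sym (ℕ.m∸n+n≡m (ℕ.≤-trans (ℕ.n≤1+n (suc q)) (total-≥ (suc (suc q)) v v≥1)))
  R : BalancingRows (suc q) vℚ (suc q)
  R = shrink (ℕ→ℚ-≢0 (v≥1 zero)) (n ∸ suc q)
        (subst (BalancingRows (suc q) vℚ) n≡[n∸q]+q (DiagonalizableToBalanced.balancingRows (suc q) v v≥1 P P-diag))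

-- If

∣n-1+n∣≡1 : ∀ n → ℕ.∣ n - suc n ∣ ≡ 1
∣n-1+n∣≡1 zero    = refl
∣n-1+n∣≡1 (suc n) = ∣n-1+n∣≡1 n

distance≥2⇒apart : ∀ {a b} → 2 ≤ ℕ.∣ a - b ∣ → a ≢ b × a ≢ suc b × suc a ≢ b
distance≥2⇒apart {a} {b} far =
    (λ { refl → contradiction (subst (2 ≤_) (ℕ.∣n-n∣≡0 a) far) λ () })
  , (λ { refl → contradiction (subst (2 ≤_) (trans (ℕ.∣-∣-comm (suc b) b) (∣n-1+n∣≡1 b)) far) λ { (s≤s ()) } })
  , (λ { refl → contradiction (subst (2 ≤_) (∣n-1+n∣≡1 a) far) λ { (s≤s ()) } })

differences-independent : ∀ k (γ : Fin k → ℚ) →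
  (∀ (x : Fin (suc k)) → ∑ (λ t → (I x (Fin.inject₁ t) - I x (suc t)) * γ t) ≡ 0ℚ) → IsZero γ
differences-independent (suc k) γ γ-relation = γ≡0
  where
  γ₀≡0 : γ zero ≡ 0ℚ
  γ₀≡0 = begin
    γ zero                                  ≡⟨ solve 1 (λ g → g := con 1ℚ :* g :+ con 0ℚ) refl (γ zero) ⟩
    1ℚ * γ zero + 0ℚ                        ≡⟨ cong (1ℚ * γ zero +_) (sym (∑-zero (λ t → *-zeroˡ (γ (suc t))))) ⟩
    ∑ (λ t → (I zero (Fin.inject₁ t) - I zero (suc t)) * γ t) ≡⟨ γ-relation zero ⟩
    0ℚ                                      ∎
  tail-relation : ∀ x → ∑ (λ t → (I x (Fin.inject₁ t) - I x (suc t)) * γ (suc t)) ≡ 0ℚ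
  tail-relation x = begin
    ∑ (λ t → (I x (Fin.inject₁ t) - I x (suc t)) * γ (suc t))
      ≡⟨ sym (+-identityˡ _) ⟩
    0ℚ + ∑ (λ t → (I x (Fin.inject₁ t) - I x (suc t)) * γ (suc t))
      ≡⟨ cong₂ _+_ (sym (trans (cong ((I (suc x) zero - I (suc x) (suc zero)) *_) γ₀≡0) (*-zeroʳ (I (suc x) zero - I (suc x) (suc zero)))))
                   (∑-cong (λ t → cong (_* γ (suc t)) (sym (cong₂ _-_ (I-suc x (Fin.inject₁ t)) (I-suc x (suc t)))))) ⟩
    ∑ (λ t → (I (suc x) (Fin.inject₁ t) - I (suc x) (suc t)) * γ t)
      ≡⟨ γ-relation (suc x) ⟩
    0ℚ ∎
  γ≡0 : IsZero γ
  γ≡0 zero    = γ₀≡0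
  γ≡0 (suc t) = differences-independent k (λ t → γ (suc t)) tail-relation t

module BalancedToDiagonalizable (q : ℕ) (v : Fin (suc q) → ℕ) (v≥1 : ∀ i → 1 ≤ v i)
  (M : Fin q → Fin (suc q) → Trit) (M·v≡0 : IsZero (⟦ M ⟧ ·ᵥ (λ i → ℕ→ℚ (v i))))
  (M-independent : ∀ b → IsZero (b ᵥ· ⟦ M ⟧) → IsZero b) where

  open Multipartite (suc q) v

  p : ℕ
  p = suc q

  v′ : Fin p → ℕ
  v′ i = ℕ.pred (v i)

  v≡1+v′ : ∀ i → v i ≡ suc (v′ i)
  v≡1+v′ i = sym (ℕ.suc-pred (v i) {{ℕ.>-nonZero (v≥1 i)}})

  n≡p+T′ : n ≡ p ℕ.+ total p v′
  n≡p+T′ = total-suc p v v′ v≡1+v′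

  inPart : ∀ i → Fin (suc (v′ i)) → Fin n
  inPart i x = vertex p v i (Fin.cast (sym (v≡1+v′ i)) x)

  part-inPart : ∀ i x → part p v (inPart i x) ≡ i
  part-inPart i x = part-vertex p v i _

  I-inPart : ∀ i (x y : Fin (suc (v′ i))) → I (inPart i x) (inPart i y) ≡ I x y
  I-inPart i x y = trans (I-vertex p v i _ _) (I-cast (sym (v≡1+v′ i)) x y)

  I-inPart-≢ : ∀ {i j} (x : Fin (suc (v′ i))) (y : Fin (suc (v′ j))) → i ≢ j → I (inPart i x) (inPart j y) ≡ 0ℚ
  I-inPart-≢ x y i≢j = I-offdiag (vertex-≢ p v _ _ i≢j)

  lower upper : ∀ i → Fin (v′ i) → Fin n
  lower i t = inPart i (Fin.inject₁ t)
  upper i t = inPart i (suc t)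

  lower≢upper : ∀ i t → lower i t ≢ upper i t
  lower≢upper i t eq = 1≢0 (begin
    1ℚ                            ≡⟨ sym (I-diag (suc t)) ⟩
    I (suc t) (suc t)             ≡⟨ sym (I-inPart i (suc t) (suc t)) ⟩
    I (upper i t) (upper i t)     ≡⟨ cong (λ u → I u (upper i t)) (sym eq) ⟩
    I (lower i t) (upper i t)     ≡⟨ I-inPart i (Fin.inject₁ t) (suc t) ⟩
    I (Fin.inject₁ t) (suc t)     ≡⟨ I-toℕ (λ eq → ℕ.1+n≢n (sym (trans (sym (Fin.toℕ-inject₁ t)) eq))) ⟩
    0ℚ                            ∎)

  difference : ∀ i → Fin (v′ i) → Fin n → Trit
  difference i t u with u Fin.≟ lower i t
  ... | yes _ = pos
  ... | no _ with u Fin.≟ upper i t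
  ...   | yes _ = neg
  ...   | no _  = zer

  difference-entry : ∀ i t u → trit (difference i t u) ≡ I u (lower i t) - I u (upper i t)
  difference-entry i t u with u Fin.≟ lower i t
  ... | yes refl = cong (λ z → 1ℚ - z) (sym (I-offdiag (lower≢upper i t)))
  ... | no _ with u Fin.≟ upper i t
  ...   | yes refl = refl
  ...   | no _     = refl

  ∑-difference : ∀ i t (f : Vector ℚ n) → ∑ (λ u → f u * trit (difference i t u)) ≡ f (lower i t) - f (upper i t)
  ∑-difference i t f = begin
    ∑ (λ u → f u * trit (difference i t u))
      ≡⟨ ∑-cong (λ u → trans (cong (f u *_) (difference-entry i t u)) (solve 3 (λ f a b → f :* (a :- b) := f :* a :- f :* b) refl (f u) (I u (lower i t)) (I u (upper i t)))) ⟩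
    ∑ (λ u → f u * I u (lower i t) - f u * I u (upper i t))
      ≡⟨ ∑-- (λ u → f u * I u (lower i t)) (λ u → f u * I u (upper i t)) ⟩
    ∑ (λ u → f u * I u (lower i t)) - ∑ (λ u → f u * I u (upper i t))
      ≡⟨ cong₂ _-_ (∑-Iʳ (lower i t) f) (∑-Iʳ (upper i t) f) ⟩
    f (lower i t) - f (upper i t) ∎

  ∑-difference-constantOnParts : ∀ i t (g : Fin p → ℚ) → ∑ (λ u → g (part p v u) * trit (difference i t u)) ≡ 0ℚ
  ∑-difference-constantOnParts i t g = trans (∑-difference i t (λ u → g (part p v u)))
    (trans (cong₂ (λ a b → g a - g b) (part-inPart i _) (part-inPart i _)) (+-inverseʳ (g i)))

  difference-outside : ∀ i t u → part p v u ≢ i → trit (difference i t u) ≡ 0ℚ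
  difference-outside i t u uᵢ≢i = trans (difference-entry i t u)
    (trans (cong₂ _-_ (I-offdiag (λ eq → uᵢ≢i (trans (cong (part p v) eq) (part-inPart i _))))
                      (I-offdiag (λ eq → uᵢ≢i (trans (cong (part p v) eq) (part-inPart i _))))) refl)

  difference-eigen : ∀ i t u → (L ·ᵥ (λ w → trit (difference i t w))) u ≡ trit (difference i t u) * (nℚ - vℚ i)
  difference-eigen i t u = trans (zeroPartSums⇒eigen _ i partSum≡0 (difference-outside i t) u) (*-comm (nℚ - vℚ i) _)
    where
    partSum≡0 : IsZero (partSum (λ w → trit (difference i t w)))
    partSum≡0 j = trans (sym (∑-I-part _ j)) (∑-difference-constantOnParts i t (I j))

  Kind : Set
  Kind = Fin p ⊎ Fin (total p v′)

  constant : Fin p → Fin p → Trit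
  constant zero    j = pos
  constant (suc k) j = M k j

  column : Kind → Fin n → Trit
  column (inj₁ s) u = constant s (part p v u)
  column (inj₂ d) u = difference (proj₁ (locate p v′ d)) (proj₂ (locate p v′ d)) u

  column-vertex : ∀ i t u → column (inj₂ (vertex p v′ i t)) u ≡ difference i t u
  column-vertex i t u = cong (λ z → difference (proj₁ z) (proj₂ z) u) (locate-vertex p v′ i t)

  kind : Fin n → Kind
  kind c = splitAt p (Fin.cast n≡p+T′ c)

  P : Fin n → Fin n → Trit
  P u c = column (kind c) u

  eigenvalue : Kind → ℚ
  eigenvalue (inj₁ zero)    = 0ℚ
  eigenvalue (inj₁ (suc k)) = nℚ
  eigenvalue (inj₂ d)       = nℚ - vℚ (proj₁ (locate p v′ d))

  column-eigen : ∀ κ u → (L ·ᵥ (λ w → trit (column κ w))) u ≡ trit (column κ u) * eigenvalue κ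
  column-eigen (inj₁ zero) u = begin
    (L ·ᵥ (λ _ → 1ℚ)) u                                              ≡⟨ L-·ᵥ (λ _ → 1ℚ) u ⟩
    (nℚ - vᵤ) * 1ℚ - (∑ {n} (λ _ → 1ℚ) - ∑ {v (part p v u)} (λ _ → 1ℚ)) ≡⟨ cong₂ (λ a b → (nℚ - vᵤ) * 1ℚ - (a - b)) (∑-1 n) (∑-1 (v (part p v u))) ⟩
    (nℚ - vᵤ) * 1ℚ - (nℚ - vᵤ)                                       ≡⟨ solve 2 (λ a b → (a :- b) :* con 1ℚ :- (a :- b) := con 1ℚ :* con 0ℚ) refl nℚ vᵤ ⟩
    1ℚ * 0ℚ                                                          ∎
    where vᵤ = vℚ (part p v u)
  column-eigen (inj₁ (suc k)) u = trans (constantOnParts⇒eigen-n {g = λ j → trit (M k j)} (λ w → refl) ∑vM≡0 u) (*-comm nℚ _)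
    where ∑vM≡0 = trans (∑-cong (λ j → *-comm (vℚ j) (trit (M k j)))) (M·v≡0 k)
  column-eigen (inj₂ d) u = difference-eigen (proj₁ (locate p v′ d)) (proj₂ (locate p v′ d)) u

  module Coefficients (α : Vector ℚ n) where

    α′ : Vector ℚ (p ℕ.+ total p v′)
    α′ κ = α (Fin.cast (sym n≡p+T′) κ)

    β : Vector ℚ p
    β s = α′ (s ↑ˡ total p v′)

    γ : ∀ i → Fin (v′ i) → ℚ
    γ i t = α′ (p ↑ʳ vertex p v′ i t)

    α≡α′ : ∀ c → α c ≡ α′ (Fin.cast n≡p+T′ c)
    α≡α′ c = cong α (sym (Fin.cast-involutive (sym n≡p+T′) n≡p+T′ c))

    ∑-kind : (Ψ : Kind → ℚ) →
      ∑ (λ c → α c * Ψ (kind c)) ≡ ∑ (λ s → β s * Ψ (inj₁ s)) + ∑ (λ i → ∑ (λ t → γ i t * Ψ (inj₂ (vertex p v′ i t))))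
    ∑-kind Ψ = begin
      ∑ (λ c → α c * Ψ (kind c))           ≡⟨ ∑-cong (λ c → cong (_* Ψ (kind c)) (α≡α′ c)) ⟩
      ∑ (λ c → G (Fin.cast n≡p+T′ c))      ≡⟨ ∑-cast n≡p+T′ G ⟩
      ∑ G                                  ≡⟨ ∑-splitAt p (total p v′) G ⟩
      ∑ (λ (s : Fin p) → G (s ↑ˡ total p v′)) + ∑ (λ d → G (p ↑ʳ d))
        ≡⟨ cong₂ _+_ (∑-cong (λ (s : Fin p) → cong (λ z → β s * Ψ z) (Fin.splitAt-↑ˡ p s (total p v′))))
                     (trans (∑-cong (λ d → cong (λ z → α′ (p ↑ʳ d) * Ψ z) (Fin.splitAt-↑ʳ p (total p v′) d)))
                            (∑-vertex p v′ (λ d → α′ (p ↑ʳ d) * Ψ (inj₂ d)))) ⟩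
      ∑ (λ s → β s * Ψ (inj₁ s)) + ∑ (λ i → ∑ (λ t → γ i t * Ψ (inj₂ (vertex p v′ i t)))) ∎
      where
      G : Vector ℚ (p ℕ.+ total p v′)
      G κ = α′ κ * Ψ (splitAt p κ)

    coefficients-zero : IsZero β → (∀ i → IsZero (γ i)) → IsZero α
    coefficients-zero β≡0 γ≡0 c = trans (α≡α′ c) (α′≡0 (Fin.cast n≡p+T′ c))
      where
      α′≡0 : IsZero α′
      α′≡0 κ with splitAt p κ in eq
      ... | inj₁ s = trans (cong α′ (sym (Fin.splitAt⁻¹-↑ˡ eq))) (β≡0 s)
      ... | inj₂ d = trans (cong α′ (sym (trans (cong (p ↑ʳ_) (vertex-locate p v′ d)) (Fin.splitAt⁻¹-↑ʳ eq))))
                           (γ≡0 (proj₁ (locate p v′ d)) (proj₂ (locate p v′ d)))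

    P·ᵥα : ∀ u → (⟦ P ⟧ ·ᵥ α) u ≡ ∑ (λ s → β s * trit (constant s (part p v u))) + ∑ (λ i → ∑ (λ t → γ i t * trit (difference i t u)))
    P·ᵥα u = begin
      (⟦ P ⟧ ·ᵥ α) u                          ≡⟨ ∑-cong (λ c → *-comm (⟦ P ⟧ u c) (α c)) ⟩
      ∑ (λ c → α c * trit (column (kind c) u)) ≡⟨ ∑-kind (λ κ → trit (column κ u)) ⟩
      ∑ (λ s → β s * trit (constant s (part p v u))) + ∑ (λ i → ∑ (λ t → γ i t * trit (column (inj₂ (vertex p v′ i t)) u)))
        ≡⟨ cong (∑ (λ s → β s * trit (constant s (part p v u))) +_) (∑-cong (λ i → ∑-cong (λ t → cong (λ z → γ i t * trit z) (column-vertex i t u)))) ⟩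
      ∑ (λ s → β s * trit (constant s (part p v u))) + ∑ (λ i → ∑ (λ t → γ i t * trit (difference i t u))) ∎

  partSum-column : ∀ j κ → ∑ (λ u → I j (part p v u) * trit (column κ u)) ≡
                           [ (λ s → vℚ j * trit (constant s j)) , (λ _ → 0ℚ) ]′ κ
  partSum-column j (inj₁ s) = begin
    ∑ (λ u → I j (part p v u) * trit (constant s (part p v u)))  ≡⟨ ∑-constantOnParts {g = λ k → I j k * trit (constant s k)} (λ u → refl) ⟩
    ∑ (λ k → vℚ k * (I j k * trit (constant s k)))               ≡⟨ ∑-cong (λ k → solve 3 (λ a b c → a :* (b :* c) := b :* (a :* c)) refl (vℚ k) (I j k) (trit (constant s k))) ⟩
    ∑ (λ k → I j k * (vℚ k * trit (constant s k)))               ≡⟨ ∑-I j (λ k → vℚ k * trit (constant s k)) ⟩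
    vℚ j * trit (constant s j)                                   ∎
  partSum-column j (inj₂ d) = ∑-difference-constantOnParts (proj₁ (locate p v′ d)) (proj₂ (locate p v′ d)) (I j)

  private
    module InKernel (α : Vector ℚ n) (P·α≡0 : IsZero (⟦ P ⟧ ·ᵥ α)) where
      open Coefficients α public

      constantPart : Fin p → ℚ
      constantPart j = ∑ (λ s → β s * trit (constant s j))

      -- the part sums of P α only see the constant columns
      constantPart≡0 : IsZero constantPart
      constantPart≡0 j = c*x≡0⇒x≡0 (vℚ j) (vℚ≢0 v≥1 j) (begin
        vℚ j * constantPart j                              ≡⟨ ∑-*ˡ (vℚ j) (λ s → β s * trit (constant s j)) ⟩
        ∑ (λ s → vℚ j * (β s * trit (constant s j)))       ≡⟨ ∑-cong (λ s → solve 3 (λ a b c → a :* (b :* c) := b :* (a :* c)) refl (vℚ j) (β s) (trit (constant s j))) ⟩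
        ∑ (λ s → β s * (vℚ j * trit (constant s j)))       ≡⟨ solve 1 (λ a → a := a :+ con 0ℚ) refl _ ⟩
        ∑ (λ s → β s * (vℚ j * trit (constant s j))) + 0ℚ  ≡⟨ cong₂ _+_ (∑-cong (λ s → cong (β s *_) (sym (partSum-column j (inj₁ s)))))
                                                                        (sym (∑-zero (λ i → ∑-zero (λ t → trans (cong (γ i t *_) (partSum-column j (inj₂ (vertex p v′ i t)))) (*-zeroʳ (γ i t)))))) ⟩
        ∑ (λ s → β s * Φ (inj₁ s)) + ∑ (λ i → ∑ (λ t → γ i t * Φ (inj₂ (vertex p v′ i t))))
                                                           ≡⟨ sym (∑-kind Φ) ⟩
        ∑ (λ c → α c * Φ (kind c))                         ≡⟨ sym (∑-·ᵥ (λ u → I j (part p v u)) ⟦ P ⟧ α) ⟩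
        ∑ (λ u → I j (part p v u) * (⟦ P ⟧ ·ᵥ α) u)        ≡⟨ ∑-zero (λ u → trans (cong (I j (part p v u) *_) (P·α≡0 u)) (*-zeroʳ (I j (part p v u)))) ⟩
        0ℚ                                                 ∎)
        where
        Φ : Kind → ℚ
        Φ κ = ∑ (λ u → I j (part p v u) * trit (column κ u))

      B : Vector ℚ q
      B k = β (suc k)

      constantPart≡β₀+B·M : ∀ j → constantPart j ≡ β zero + (B ᵥ· ⟦ M ⟧) j
      constantPart≡β₀+B·M j = cong (_+ (B ᵥ· ⟦ M ⟧) j) (*-identityʳ (β zero))

      -- weighting the part equations by v kills the rows of M, because M v = 0
      nβ₀≡0 : nℚ * β zero ≡ 0ℚ
      nβ₀≡0 = begin
        nℚ * β zero                                              ≡⟨ cong (_* β zero) (ℕ→ℚ-total p v) ⟩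
        ∑ vℚ * β zero                                            ≡⟨ solve 1 (λ a → a := a :+ con 0ℚ) refl _ ⟩
        ∑ vℚ * β zero + 0ℚ                                       ≡⟨ cong₂ _+_ (∑-*ʳ (β zero) vℚ) (sym (∑-zero (λ k → trans (cong (B k *_) (M·v≡0 k)) (*-zeroʳ (B k))))) ⟩
        ∑ (λ j → vℚ j * β zero) + ∑ (λ k → B k * (⟦ M ⟧ ·ᵥ vℚ) k) ≡⟨ cong (∑ (λ j → vℚ j * β zero) +_) (∑-·ᵥ B ⟦ M ⟧ vℚ) ⟩
        ∑ (λ j → vℚ j * β zero) + ∑ (λ j → vℚ j * (B ᵥ· ⟦ M ⟧) j) ≡⟨ sym (∑-+ (λ j → vℚ j * β zero) (λ j → vℚ j * (B ᵥ· ⟦ M ⟧) j)) ⟩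
        ∑ (λ j → vℚ j * β zero + vℚ j * (B ᵥ· ⟦ M ⟧) j)          ≡⟨ ∑-cong (λ j → trans (sym (*-distribˡ-+ (vℚ j) (β zero) ((B ᵥ· ⟦ M ⟧) j))) (cong (vℚ j *_) (sym (constantPart≡β₀+B·M j)))) ⟩
        ∑ (λ j → vℚ j * constantPart j)                          ≡⟨ ∑-zero (λ j → trans (cong (vℚ j *_) (constantPart≡0 j)) (*-zeroʳ (vℚ j))) ⟩
        0ℚ                                                       ∎

      n≢0 : nℚ ≢ 0ℚ
      n≢0 = ℕ→ℚ-≢0 (ℕ.≤-trans (s≤s z≤n) (total-≥ p v v≥1))

      β≡0 : IsZero β
      β≡0 zero    = c*x≡0⇒x≡0 nℚ n≢0 nβ₀≡0
      β≡0 (suc k) = M-independent B (λ j → trans (sym (+-identityˡ ((B ᵥ· ⟦ M ⟧) j)))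
        (trans (cong (_+ (B ᵥ· ⟦ M ⟧) j) (sym (β≡0 zero))) (trans (sym (constantPart≡β₀+B·M j)) (constantPart≡0 j)))) k

      -- evaluated at the vertices of part i, P α = 0 only involves the differences inside part i
      γ≡0 : ∀ i → IsZero (γ i)
      γ≡0 i = differences-independent (v′ i) (γ i) (λ x → let u = inPart i x in begin
        ∑ (λ t → (I x (Fin.inject₁ t) - I x (suc t)) * γ i t)
          ≡⟨ ∑-cong (λ t → trans (*-comm _ (γ i t)) (cong (γ i t *_) (sym (trans (difference-entry i t u) (cong₂ _-_ (I-inPart i x (Fin.inject₁ t)) (I-inPart i x (suc t))))))) ⟩
        ∑ (λ t → γ i t * trit (difference i t u))
          ≡⟨ sym (∑-single i (λ i′ → ∑ (λ t → γ i′ t * trit (difference i′ t u))) (λ i′ i′≢i → ∑-zero (λ t →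
               trans (cong (γ i′ t *_) (difference-outside i′ t u (λ eq → i′≢i (trans (sym eq) (part-inPart i x))))) (*-zeroʳ (γ i′ t))))) ⟩
        ∑ (λ i′ → ∑ (λ t → γ i′ t * trit (difference i′ t u)))
          ≡⟨ sym (+-identityˡ _) ⟩
        0ℚ + ∑ (λ i′ → ∑ (λ t → γ i′ t * trit (difference i′ t u)))
          ≡⟨ cong (_+ ∑ (λ i′ → ∑ (λ t → γ i′ t * trit (difference i′ t u)))) (sym (∑-zero (λ s → trans (cong (_* trit (constant s (part p v u))) (β≡0 s)) (*-zeroˡ (trit (constant s (part p v u))))))) ⟩
        ∑ (λ s → β s * trit (constant s (part p v u))) + ∑ (λ i′ → ∑ (λ t → γ i′ t * trit (difference i′ t u)))
          ≡⟨ trans (sym (P·ᵥα u)) (P·α≡0 u) ⟩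
        0ℚ ∎)

  P-trivialKernel : TrivialKernel ⟦ P ⟧
  P-trivialKernel α P·α≡0 = coefficients-zero β≡0 γ≡0
    where open InKernel α P·α≡0

  P-diagonalizes : Diagonalizes L P
  P-diagonalizes = Q , Q-inverse , Q·L·P-diagonal
    where
    Q = proj₁ (trivialKernel⇒invertible ⟦ P ⟧ P-trivialKernel)
    Q-inverse = proj₂ (trivialKernel⇒invertible ⟦ P ⟧ P-trivialKernel)
    Q·L·P-diagonal : IsDiagonal (Q · (L · ⟦ P ⟧))
    Q·L·P-diagonal c c′ c≢c′ = begin
      ∑ (λ l → Q c l * (L · ⟦ P ⟧) l c′)          ≡⟨ ∑-cong (λ l → trans (cong (Q c l *_) (column-eigen (kind c′) l)) (sym (*-assoc (Q c l) (⟦ P ⟧ l c′) λ′))) ⟩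
      ∑ (λ l → Q c l * ⟦ P ⟧ l c′ * λ′)            ≡⟨ sym (∑-*ʳ λ′ (λ l → Q c l * ⟦ P ⟧ l c′)) ⟩
      (Q · ⟦ P ⟧) c c′ * λ′                        ≡⟨ cong (_* λ′) (trans (proj₁ Q-inverse c c′) (I-offdiag c≢c′)) ⟩
      0ℚ * λ′                                      ≡⟨ *-zeroˡ λ′ ⟩
      0ℚ                                           ∎
      where λ′ = eigenvalue (kind c′)

  gram : Kind → Kind → ℚ
  gram κ κ′ = ∑ (λ u → trit (column κ u) * trit (column κ′ u))

  gram-sym : ∀ κ κ′ → gram κ κ′ ≡ gram κ′ κ
  gram-sym κ κ′ = ∑-cong (λ u → *-comm (trit (column κ u)) (trit (column κ′ u)))

  gram-constant-difference : ∀ s d → gram (inj₁ s) (inj₂ d) ≡ 0ℚ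
  gram-constant-difference s d = ∑-difference-constantOnParts (proj₁ (locate p v′ d)) (proj₂ (locate p v′ d)) (λ j → trit (constant s j))

  gram-ones-row : ∀ k → gram (inj₁ zero) (inj₁ (suc k)) ≡ 0ℚ
  gram-ones-row k = begin
    ∑ (λ u → 1ℚ * trit (M k (part p v u)))  ≡⟨ ∑-cong (λ u → *-identityˡ (trit (M k (part p v u)))) ⟩
    ∑ (λ u → trit (M k (part p v u)))       ≡⟨ ∑-constantOnParts {g = λ j → trit (M k j)} (λ u → refl) ⟩
    ∑ (λ j → vℚ j * trit (M k j))           ≡⟨ ∑-cong (λ j → *-comm (vℚ j) (trit (M k j))) ⟩
    (⟦ M ⟧ ·ᵥ vℚ) k                         ≡⟨ M·v≡0 k ⟩
    0ℚ                                      ∎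

  gram-differences : ∀ i t i′ t′ → gram (inj₂ (vertex p v′ i t)) (inj₂ (vertex p v′ i′ t′)) ≡
    (I (lower i′ t′) (lower i t) - I (lower i′ t′) (upper i t)) - (I (upper i′ t′) (lower i t) - I (upper i′ t′) (upper i t))
  gram-differences i t i′ t′ = begin
    gram (inj₂ (vertex p v′ i t)) (inj₂ (vertex p v′ i′ t′))
      ≡⟨ ∑-cong (λ u → cong₂ (λ a b → trit a * trit b) (column-vertex i t u) (column-vertex i′ t′ u)) ⟩
    ∑ (λ u → trit (difference i t u) * trit (difference i′ t′ u))
      ≡⟨ ∑-difference i′ t′ (λ u → trit (difference i t u)) ⟩
    trit (difference i t (lower i′ t′)) - trit (difference i t (upper i′ t′))
      ≡⟨ cong₂ _-_ (difference-entry i t (lower i′ t′)) (difference-entry i t (upper i′ t′)) ⟩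
    (I (lower i′ t′) (lower i t) - I (lower i′ t′) (upper i t)) - (I (upper i′ t′) (lower i t) - I (upper i′ t′) (upper i t)) ∎

  gram-differences-≢ : ∀ {i i′} t t′ → i′ ≢ i → gram (inj₂ (vertex p v′ i t)) (inj₂ (vertex p v′ i′ t′)) ≡ 0ℚ
  gram-differences-≢ {i} {i′} t t′ i′≢i = trans (gram-differences i t i′ t′)
    (cong₂ _-_ (cong₂ _-_ (I-inPart-≢ _ _ i′≢i) (I-inPart-≢ _ _ i′≢i)) (cong₂ _-_ (I-inPart-≢ _ _ i′≢i) (I-inPart-≢ _ _ i′≢i)))

  gram-differences-far : ∀ i (t t′ : Fin (v′ i)) → 2 ≤ ℕ.∣ toℕ t - toℕ t′ ∣ →
                         gram (inj₂ (vertex p v′ i t)) (inj₂ (vertex p v′ i t′)) ≡ 0ℚ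
  gram-differences-far i t t′ far = trans (gram-differences i t i t′)
    (cong₂ _-_ (cong₂ _-_ (trans (I-inPart i _ _) (I-toℕ t′≉t)) (trans (I-inPart i _ _) (I-toℕ t′≉1+t)))
               (cong₂ _-_ (trans (I-inPart i _ _) (I-toℕ 1+t′≉t)) (trans (I-inPart i _ _) (I-toℕ (λ eq → t≢t′ (sym (ℕ.suc-injective eq)))))))
    where
    apart = distance≥2⇒apart far
    t≢t′ = proj₁ apart
    t≢1+t′ = proj₁ (proj₂ apart)
    1+t≢t′ = proj₂ (proj₂ apart)
    t′≉t : toℕ (Fin.inject₁ t′) ≢ toℕ (Fin.inject₁ t)
    t′≉t eq = t≢t′ (sym (trans (sym (Fin.toℕ-inject₁ t′)) (trans eq (Fin.toℕ-inject₁ t))))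
    t′≉1+t : toℕ (Fin.inject₁ t′) ≢ toℕ (suc t)
    t′≉1+t eq = 1+t≢t′ (sym (trans (sym (Fin.toℕ-inject₁ t′)) eq))
    1+t′≉t : toℕ (suc t′) ≢ toℕ (Fin.inject₁ t)
    1+t′≉t eq = t≢1+t′ (sym (trans eq (Fin.toℕ-inject₁ t)))

  gram-vertex-differences : ∀ i t i′ t′ → 2 ≤ ℕ.∣ toℕ (vertex p v′ i t) - toℕ (vertex p v′ i′ t′) ∣ →
                            gram (inj₂ (vertex p v′ i t)) (inj₂ (vertex p v′ i′ t′)) ≡ 0ℚ
  gram-vertex-differences i t i′ t′ far with i′ Fin.≟ i
  ... | no i′≢i  = gram-differences-≢ t t′ i′≢i
  ... | yes refl = gram-differences-far i t t′
    (subst (2 ≤_) (trans (cong₂ ℕ.∣_-_∣ (toℕ-vertex p v′ i t) (toℕ-vertex p v′ i t′)) (ℕ.∣m+n-m+o∣≡∣n-o∣ (offset p v′ i) (toℕ t) (toℕ t′))) far)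

  gram-far-differences : ∀ d d′ → 2 ≤ ℕ.∣ toℕ d - toℕ d′ ∣ → gram (inj₂ d) (inj₂ d′) ≡ 0ℚ
  gram-far-differences d d′ far = subst₂ (λ a b → gram (inj₂ a) (inj₂ b) ≡ 0ℚ) (vertex-locate p v′ d) (vertex-locate p v′ d′)
    (gram-vertex-differences (proj₁ (locate p v′ d)) (proj₂ (locate p v′ d)) (proj₁ (locate p v′ d′)) (proj₂ (locate p v′ d′)) (subst₂ (λ a b → 2 ≤ ℕ.∣ toℕ a - toℕ b ∣) (sym (vertex-locate p v′ d)) (sym (vertex-locate p v′ d′)) far))

  -- two rows of M sit at distance < q, so only their pairing with the all-ones column matters
  gram-far-constants : ∀ s s′ → 2 ⊔ q ≤ ℕ.∣ toℕ s - toℕ s′ ∣ → gram (inj₁ s) (inj₁ s′) ≡ 0ℚ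
  gram-far-constants zero    zero    far = contradiction (ℕ.m⊔n≤o⇒m≤o 2 q far) λ ()
  gram-far-constants zero    (suc k) far = gram-ones-row k
  gram-far-constants (suc k) zero    far = trans (gram-sym (inj₁ (suc k)) (inj₁ zero)) (gram-ones-row k)
  gram-far-constants (suc a) (suc b) far = contradiction
    (ℕ.≤-trans (ℕ.m⊔n≤o⇒n≤o 2 q far) (ℕ.∣m-n∣≤m⊔n (toℕ a) (toℕ b)))
    (ℕ.<⇒≱ (ℕ.⊔-lub (Fin.toℕ<n a) (Fin.toℕ<n b)))

  gram-far-kinds : ∀ κ κ′ → 2 ⊔ q ≤ ℕ.∣ toℕ κ - toℕ κ′ ∣ → gram (splitAt p κ) (splitAt p κ′) ≡ 0ℚ
  gram-far-kinds κ κ′ far with splitAt p κ in eq | splitAt p κ′ in eq′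
  ... | inj₁ s | inj₁ s′ = gram-far-constants s s′ (subst₂ (λ a b → 2 ⊔ q ≤ ℕ.∣ a - b ∣) (toℕ-inj₁ {κ} eq) (toℕ-inj₁ {κ′} eq′) far)
    where
    toℕ-inj₁ : ∀ {κ s} → splitAt p κ ≡ inj₁ s → toℕ κ ≡ toℕ s
    toℕ-inj₁ {κ} {s} eq = trans (cong toℕ (sym (Fin.splitAt⁻¹-↑ˡ eq))) (Fin.toℕ-↑ˡ s (total p v′))
  ... | inj₁ s | inj₂ d  = gram-constant-difference s d
  ... | inj₂ d | inj₁ s  = trans (gram-sym (inj₂ d) (inj₁ s)) (gram-constant-difference s d)
  ... | inj₂ d | inj₂ d′ = gram-far-differences d d′
    (subst (2 ≤_) (trans (cong₂ ℕ.∣_-_∣ (toℕ-inj₂ {κ} eq) (toℕ-inj₂ {κ′} eq′)) (ℕ.∣m+n-m+o∣≡∣n-o∣ p (toℕ d) (toℕ d′))) (ℕ.m⊔n≤o⇒m≤o 2 q far))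
    where
    toℕ-inj₂ : ∀ {κ d} → splitAt p κ ≡ inj₂ d → toℕ κ ≡ p ℕ.+ toℕ d
    toℕ-inj₂ {κ} {d} eq = trans (cong toℕ (sym (Fin.splitAt⁻¹-↑ʳ eq))) (Fin.toℕ-↑ʳ p d)

  P-bandwidth : BandwidthAtMost ((⟦ P ⟧ ᵀ) · ⟦ P ⟧) (2 ⊔ q)
  P-bandwidth c c′ far = gram-far-kinds (Fin.cast n≡p+T′ c) (Fin.cast n≡p+T′ c′)
    (subst₂ (λ a b → 2 ⊔ q ≤ ℕ.∣ a - b ∣) (sym (Fin.toℕ-cast n≡p+T′ c)) (sym (Fin.toℕ-cast n≡p+T′ c′)) far)

balanced⇒bandwidth : ∀ q (v : Fin (suc q) → ℕ) → (∀ i → 1 ≤ v i) → Balanced (suc q) (λ i → ℕ→ℚ (v i)) →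
  TritBandwidthAtMost (multipartiteLaplacian (suc q) v) (2 ⊔ q)
balanced⇒bandwidth zero v v≥1 _ = P , P-diagonalizes , P-bandwidth
  where open BalancedToDiagonalizable zero v v≥1 (λ ()) (λ ()) (λ _ _ ())
balanced⇒bandwidth (suc q) v v≥1 (M , M-nullSpace) = P , P-diagonalizes , P-bandwidth
  where
  vℚ = λ i → ℕ→ℚ (v i)
  M·v≡0 : IsZero (⟦ M ⟧ ·ᵥ vℚ)
  M·v≡0 = proj₂ (M-nullSpace vℚ) (1ℚ , λ j → sym (*-identityˡ (vℚ j)))
  M-independent = kernel⊆span⇒rowsIndependent q ⟦ M ⟧ vℚ (ℕ→ℚ-≢0 (v≥1 zero)) (λ x → proj₁ (M-nullSpace x))
  open BalancedToDiagonalizable (suc q) v v≥1 M M·v≡0 M-independent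

corollary4p10 : (p : ℕ) (v : Fin p → ℕ) → 1 ≤ p → (∀ i → 1 ≤ v i) →
    (TritDiagonalizable (multipartiteLaplacian p v) ⇔ Balanced p (λ i → ℕ→ℚ (v i)))
    × (TritDiagonalizable (multipartiteLaplacian p v) →
         TritBandwidthAtMost (multipartiteLaplacian p v) (2 ⊔ (p ∸ 1)))
corollary4p10 (suc q) v _ v≥1 =
  mk⇔ balanced (λ bal → let P , P-diag , _ = balanced⇒bandwidth q v v≥1 bal in P , P-diag) ,
  λ diag → balanced⇒bandwidth q v v≥1 (balanced diag)
  where balanced = diagonalizable⇒balanced q v v≥1
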